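{- Let $H$ be an arbitrary bipartite graph. If $0\leq x\leq 1$ and $y\geq 1$, or $0\leq y\leq 1$ and $x\geq 1$, then $$\widetilde{T}_H(x,y)\widetilde{T}_H(1,1)\geq \widetilde{T}_H(x,1)\widetilde{T}_H(1,y).$$ If both $x,y\geq 1$, or both $0\leq x,y\leq 1$, then $$\widetilde{T}_H(x,y)\widetilde{T}_H(1,1)\leq \widetilde{T}_H(x,1)\widetilde{T}_H(1,y).$$
   Context: A bipartite graph $H=(A,B,E)$ comes with designated sides $A,B$ (isolated vertices allowed). For $m=|V(H)|$ and a permutation $\pi$ of $V(H)$ (a bijection to $[m]$), a vertex $i\in A$ is internally active if $\pi(i)>\pi(j)$ for all neighbours $j$ of $i$, and $j\in B$ is externally active if $\pi(j)>\pi(i)$ for all neighbours $i$ of $j$ (vacuous for isolated vertices); $\mathrm{ia}(\pi),\mathrm{ea}(\pi)$ are their numbers, and $\widetilde{T}_H(x,y)=\frac{1}{m!}\sum_{\pi}x^{\mathrm{ia}(\pi)}y^{\mathrm{ea}(\pi)}$.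
   Formalization: The variables $x$ and $y$ range over the rationals. -}

module Defs where

open import Data.Bool using (Bool; true; false; _∧_; _∨_; not)
open import Data.Nat as ℕ using (ℕ; zero; suc; _!)
open import Data.Nat.Properties using (_!≢0)
open import Data.Fin as Fin using (Fin; zero; suc; _<?_; _≟_)
open import Data.Sum using (_⊎_; inj₁; inj₂)
open import Data.List as List using (List; []; _∷_; map; concatMap; filterᵇ; foldr)
open import Data.Integer using (+_)
open import Data.Rational as ℚ using (ℚ; 0ℚ; 1ℚ; _+_; _*_)
open import Relation.Nullary.Decidable using (⌊_⌋)

-- A bipartite graph H = (A, B, E) with designated sides A = Fin a, B = Fin b
-- (isolated vertices allowed): E i j = true iff i ∈ A and j ∈ B are adjacent.
record BipGraph : Set where
  field
    a : ℕ
    b : ℕ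
    E : Fin a → Fin b → Bool
open BipGraph public

Vertex : BipGraph → Set
Vertex H = Fin (a H) ⊎ Fin (b H)

order : BipGraph → ℕ
order H = a H ℕ.+ b H

-- A labelling π : V(H) → [m] is given by its two restrictions to A and B.
record Labelling (H : BipGraph) : Set where
  constructor lab
  field
    πA : Fin (a H) → Fin (order H)
    πB : Fin (b H) → Fin (order H)

apply : {H : BipGraph} → Labelling H → Vertex H → Fin (order H)
apply (lab f g) (inj₁ i) = f i
apply (lab f g) (inj₂ j) = g j

allFuns : (n k : ℕ) → List (Fin n → Fin k)
allFuns zero    k = (λ ()) ∷ []
allFuns (suc n) k =
  concatMap (λ c → map (λ f → λ { zero → c ; (suc i) → f i }) (allFuns n k)) (List.allFin k)

allFin : (n : ℕ) → (Fin n → Bool) → Bool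
allFin n p = foldr (λ i r → p i ∧ r) true (List.allFin n)

_≠ᵇ_ : {k : ℕ} → Fin k → Fin k → Bool
u ≠ᵇ v = not ⌊ u ≟ v ⌋

_⇒ᵇ_ : Bool → Bool → Bool
p ⇒ᵇ q = not p ∨ q

-- π is injective on V(H) = A ⊎ B (hence a bijection V(H) → [m], as |V(H)| = m).
isPerm : {H : BipGraph} → Labelling H → Bool
isPerm {H} (lab f g) =
  allFin (a H) (λ i → allFin (a H) (λ i' → (i ≠ᵇ i') ⇒ᵇ (f i ≠ᵇ f i')))
  ∧ allFin (b H) (λ j → allFin (b H) (λ j' → (j ≠ᵇ j') ⇒ᵇ (g j ≠ᵇ g j')))
  ∧ allFin (a H) (λ i → allFin (b H) (λ j → f i ≠ᵇ g j))

perms : (H : BipGraph) → List (Labelling H)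
perms H = filterᵇ isPerm
  (concatMap (λ f → map (lab f) (allFuns (b H) (order H))) (allFuns (a H) (order H)))

internallyActive : {H : BipGraph} → Labelling H → Fin (a H) → Bool
internallyActive {H} (lab f g) i = allFin (b H) (λ j → E H i j ⇒ᵇ ⌊ g j <? f i ⌋)

externallyActive : {H : BipGraph} → Labelling H → Fin (b H) → Bool
externallyActive {H} (lab f g) j = allFin (a H) (λ i → E H i j ⇒ᵇ ⌊ f i <? g j ⌋)

count : (n : ℕ) → (Fin n → Bool) → ℕ
count n p = List.length (filterᵇ p (List.allFin n))

ia : {H : BipGraph} → Labelling H → ℕ
ia {H} π = count (a H) (internallyActive π)

ea : {H : BipGraph} → Labelling H → ℕ
ea {H} π = count (b H) (externallyActive π)

_^_ : ℚ → ℕ → ℚ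
x ^ zero  = 1ℚ
x ^ suc n = x * (x ^ n)

Ttilde : BipGraph → ℚ → ℚ → ℚ
Ttilde H x y =
  ((+ 1) ℚ./ (order H !)) {{order H !≢0}}
  * foldr _+_ 0ℚ (map (λ π → (x ^ ia π) * (y ^ ea π)) (perms H))

module Submission where

-- Label the vertices of H independently and uniformly by [N] = {0, …, N − 1}.  Ordering
-- labellings by raising the labels on A and lowering those on B, ia is increasing and ea is
-- decreasing, so for x, y ≥ 0 the weights x^ia and y^ea are monotone, in a direction fixed
-- by the sign of x − 1 and of y − 1.  The Harris inequality for this product order, proved
-- from Chebyshev's sum inequality by induction on the number of vertices, bounds
-- E[x^ia y^ea] against E[x^ia] E[y^ea].  An injective labelling induces a uniformly random
-- permutation with the same activities, and a labelling is injective with probability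
-- 1 − O(1/N); letting N → ∞ transfers the inequality to the averages T̃ over permutations.
-- A decreasing weight W is traded for the increasing weight c − W, which reverses the sign
-- of the covariance.

open import Defs
open import Data.Product using (_×_)
open import Data.Sum using (_⊎_)
open import Data.Rational using (ℚ; 0ℚ; 1ℚ; _≤_; _*_)
open import Data.Bool using (Bool; true; false; _∧_; not; if_then_else_; T; T?)
open import Data.Bool.Properties using (T-∧; if-∧; ∧-assoc; ∧-identityʳ)
open import Data.Empty using (⊥-elim)
open import Data.Fin as Fin using (Fin; zero; suc; _<?_; _≟_; punchIn)
import Data.Fin.Properties as Fin
import Data.Integer as ℤ
import Data.Integer.Properties as ℤ
open import Data.List as List using (List; []; _∷_; map; concatMap; filterᵇ; foldr; _++_)
import Data.List.Properties as List
open import Data.List.Relation.Unary.All as All using (All)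
open import Data.List.Relation.Unary.All.Properties using (tabulate⁺; tabulate⁻)
open import Data.Nat as ℕ using (ℕ; zero; suc; _!)
import Data.Nat.Coprimality as Coprimality
import Data.Nat.Properties as ℕ
open import Data.Nat.Properties using (_!≢0)
open import Data.Product using (_,_; proj₁; proj₂; ∃)
open import Data.Rational as ℚ using (_+_; -_; _-_; _<_; mkℚ)
import Data.Rational.Properties as ℚ
open import Data.Rational.Solver using (module +-*-Solver)
open import Data.Sum using (inj₁; inj₂)
open import Data.Unit.Base using (tt)
import Data.Vec.Functional as VF
open import Data.Vec.Functional.Relation.Binary.Pointwise using (Pointwise)
open import Function using (_∘_; const; flip; id; case_of_)
open import Function.Bundles using (Equivalence)
open import Function.Definitions using (Injective)
open import Relation.Binary.Definitions using (Reflexive; Total; Monotonic₁; Monotonic₂)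
open import Relation.Binary.PropositionalEquality
open import Relation.Nullary using (yes; no)
open import Relation.Nullary.Decidable using (⌊_⌋; toWitness; fromWitness; toWitnessFalse; fromWitnessFalse)

open +-*-Solver using (solve; _:+_; _:*_; _:-_; :-_; _:=_; con)

0≤1 : 0ℚ ≤ 1ℚ
0≤1 = ℚ.nonNegative⁻¹ 1ℚ

*-monoˡ-≤ : ∀ {r p q} → 0ℚ ≤ r → p ≤ q → r * p ≤ r * q
*-monoˡ-≤ {r} 0≤r = ℚ.*-monoˡ-≤-nonNeg r {{ℚ.nonNegative 0≤r}}

*-monoʳ-≤ : ∀ {r p q} → 0ℚ ≤ r → p ≤ q → p * r ≤ q * r
*-monoʳ-≤ {r} 0≤r = ℚ.*-monoʳ-≤-nonNeg r {{ℚ.nonNegative 0≤r}}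

*-mono-≤ : ∀ {p q r s} → 0ℚ ≤ q → 0ℚ ≤ r → p ≤ q → r ≤ s → p * r ≤ q * s
*-mono-≤ 0≤q 0≤r p≤q r≤s = ℚ.≤-trans (*-monoʳ-≤ 0≤r p≤q) (*-monoˡ-≤ 0≤q r≤s)

*-nonNeg : ∀ {p q} → 0ℚ ≤ p → 0ℚ ≤ q → 0ℚ ≤ p * q
*-nonNeg {p} 0≤p 0≤q = ℚ.≤-trans (ℚ.≤-reflexive (sym (ℚ.*-zeroʳ p))) (*-monoˡ-≤ 0≤p 0≤q)

+-nonNeg : ∀ {p q} → 0ℚ ≤ p → 0ℚ ≤ q → 0ℚ ≤ p + q
+-nonNeg = ℚ.+-mono-≤

p≤p+q : ∀ p {q} → 0ℚ ≤ q → p ≤ p + q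
p≤p+q p 0≤q = ℚ.≤-trans (ℚ.≤-reflexive (sym (ℚ.+-identityʳ p))) (ℚ.+-monoʳ-≤ p 0≤q)

square-nonNeg : ∀ p → 0ℚ ≤ p * p
square-nonNeg p with ℚ.≤-total 0ℚ p
... | inj₁ 0≤p = *-nonNeg 0≤p 0≤p
... | inj₂ p≤0 = ℚ.≤-trans (*-nonNeg 0≤-p 0≤-p) (ℚ.≤-reflexive (neg*neg p))
  where
  0≤-p : 0ℚ ≤ - p
  0≤-p = ℚ.neg-antimono-≤ p≤0
  neg*neg : ∀ p → (- p) * (- p) ≡ p * p
  neg*neg = solve 1 (λ p → (:- p) :* (:- p) := p :* p) refl

0≤q-p⇒p≤q : ∀ {p q} → 0ℚ ≤ q - p → p ≤ q
0≤q-p⇒p≤q {p} {q} 0≤q-p = begin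
  p          ≡⟨ sym (ℚ.+-identityˡ p) ⟩
  0ℚ + p     ≤⟨ ℚ.+-monoˡ-≤ p 0≤q-p ⟩
  q - p + p  ≡⟨ solve 2 (λ p q → q :- p :+ p := q) refl p q ⟩
  q          ∎
  where open ℚ.≤-Reasoning

p≤q⇒0≤q-p : ∀ {p q} → p ≤ q → 0ℚ ≤ q - p
p≤q⇒0≤q-p {p} {q} p≤q = begin
  0ℚ     ≡⟨ sym (ℚ.+-inverseʳ p) ⟩
  p - p  ≤⟨ ℚ.+-monoˡ-≤ (- p) p≤q ⟩
  q - p  ∎
  where open ℚ.≤-Reasoning

p-q≤0⇒p≤q : ∀ {p q} → p - q ≤ 0ℚ → p ≤ q
p-q≤0⇒p≤q {p} {q} p-q≤0 = begin
  p          ≡⟨ solve 2 (λ p q → p := p :- q :+ q) refl p q ⟩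
  p - q + q  ≤⟨ ℚ.+-monoˡ-≤ q p-q≤0 ⟩
  0ℚ + q     ≡⟨ ℚ.+-identityˡ q ⟩
  q          ∎
  where open ℚ.≤-Reasoning

p≤q+r⇒p-q≤r : ∀ {p q r} → p ≤ q + r → p - q ≤ r
p≤q+r⇒p-q≤r {p} {q} {r} p≤q+r = begin
  p - q      ≤⟨ ℚ.+-monoˡ-≤ (- q) p≤q+r ⟩
  q + r - q  ≡⟨ solve 2 (λ q r → q :+ r :- q := r) refl q r ⟩
  r          ∎
  where open ℚ.≤-Reasoning

0≤-p⇒p≤0 : ∀ {p} → 0ℚ ≤ - p → p ≤ 0ℚ
0≤-p⇒p≤0 {p} 0≤-p = ℚ.≤-trans (ℚ.≤-reflexive (neg-involutive p)) (ℚ.neg-antimono-≤ 0≤-p)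
  where
  neg-involutive : ∀ p → p ≡ - (- p)
  neg-involutive = solve 1 (λ p → p := :- (:- p)) refl

half-cancel-≤ : ∀ {p q} → p + p ≤ q + q → p ≤ q
half-cancel-≤ {p} {q} 2p≤2q = ℚ.*-cancelˡ-≤-pos (1ℚ + 1ℚ) (begin
  (1ℚ + 1ℚ) * p  ≡⟨ solve 1 (λ p → (con 1ℚ :+ con 1ℚ) :* p := p :+ p) refl p ⟩
  p + p          ≤⟨ 2p≤2q ⟩
  q + q          ≡⟨ solve 1 (λ q → q :+ q := (con 1ℚ :+ con 1ℚ) :* q) refl q ⟩
  (1ℚ + 1ℚ) * q  ∎)
  where open ℚ.≤-Reasoning

*-cancelˡ-≡ : ∀ {d p q} → 0ℚ < d → d * p ≡ d * q → p ≡ q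
*-cancelˡ-≡ {d} 0<d dp≡dq = ℚ.≤-antisym
  (ℚ.*-cancelˡ-≤-pos d {{ℚ.positive 0<d}} (ℚ.≤-reflexive dp≡dq))
  (ℚ.*-cancelˡ-≤-pos d {{ℚ.positive 0<d}} (ℚ.≤-reflexive (sym dp≡dq)))

∑ : {A : Set} → List A → (A → ℚ) → ℚ
∑ xs f = foldr _+_ 0ℚ (map f xs)

syntax ∑ xs (λ x → e) = ∑[ x ∈ xs ] e

card : {A : Set} → List A → ℚ
card xs = ∑[ _ ∈ xs ] 1ℚ

module _ {A : Set} where

  ∑-cong : ∀ (xs : List A) {f g} → (∀ x → f x ≡ g x) → ∑ xs f ≡ ∑ xs g
  ∑-cong []       f≗g = refl
  ∑-cong (x ∷ xs) f≗g = cong₂ _+_ (f≗g x) (∑-cong xs f≗g)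

  ∑-++ : ∀ (xs ys : List A) f → ∑ (xs ++ ys) f ≡ ∑ xs f + ∑ ys f
  ∑-++ []       ys f = sym (ℚ.+-identityˡ (∑ ys f))
  ∑-++ (x ∷ xs) ys f = trans (cong (f x +_) (∑-++ xs ys f)) (sym (ℚ.+-assoc (f x) (∑ xs f) (∑ ys f)))

  ∑-0 : ∀ (xs : List A) → ∑[ _ ∈ xs ] 0ℚ ≡ 0ℚ
  ∑-0 []       = refl
  ∑-0 (x ∷ xs) = trans (ℚ.+-identityˡ (∑[ _ ∈ xs ] 0ℚ)) (∑-0 xs)

  ∑-+ : ∀ (xs : List A) f g → ∑[ x ∈ xs ] (f x + g x) ≡ ∑ xs f + ∑ xs g
  ∑-+ []       f g = refl
  ∑-+ (x ∷ xs) f g = trans (cong (f x + g x +_) (∑-+ xs f g)) (+-interchange (f x) (g x) (∑ xs f) (∑ xs g))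
    where
    +-interchange : ∀ p q r s → p + q + (r + s) ≡ p + r + (q + s)
    +-interchange = solve 4 (λ p q r s → p :+ q :+ (r :+ s) := p :+ r :+ (q :+ s)) refl

  ∑-neg : ∀ (xs : List A) f → ∑[ x ∈ xs ] (- f x) ≡ - ∑ xs f
  ∑-neg []       f = refl
  ∑-neg (x ∷ xs) f = trans (cong (- f x +_) (∑-neg xs f)) (sym (ℚ.neg-distrib-+ (f x) (∑ xs f)))

  ∑-difference : ∀ (xs : List A) f g → ∑[ x ∈ xs ] (f x - g x) ≡ ∑ xs f - ∑ xs g
  ∑-difference xs f g = trans (∑-+ xs f (λ x → - g x)) (cong (∑ xs f +_) (∑-neg xs g))

  ∑-*ˡ : ∀ (xs : List A) c f → ∑[ x ∈ xs ] (c * f x) ≡ c * ∑ xs f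
  ∑-*ˡ []       c f = sym (ℚ.*-zeroʳ c)
  ∑-*ˡ (x ∷ xs) c f = trans (cong (c * f x +_) (∑-*ˡ xs c f)) (sym (ℚ.*-distribˡ-+ c (f x) (∑ xs f)))

  ∑-*ʳ : ∀ (xs : List A) c f → ∑[ x ∈ xs ] (f x * c) ≡ ∑ xs f * c
  ∑-*ʳ xs c f = trans (∑-cong xs (λ x → ℚ.*-comm (f x) c)) (trans (∑-*ˡ xs c f) (ℚ.*-comm c (∑ xs f)))

  ∑-const : ∀ (xs : List A) c → ∑[ _ ∈ xs ] c ≡ c * card xs
  ∑-const xs c = trans (∑-cong xs (λ _ → sym (ℚ.*-identityʳ c))) (∑-*ˡ xs c (const 1ℚ))

  ∑-mono-≤ : ∀ (xs : List A) {f g} → (∀ x → f x ≤ g x) → ∑ xs f ≤ ∑ xs g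
  ∑-mono-≤ []       f≤g = ℚ.≤-refl
  ∑-mono-≤ (x ∷ xs) f≤g = ℚ.+-mono-≤ (f≤g x) (∑-mono-≤ xs f≤g)

  ∑-nonNeg : ∀ (xs : List A) {f} → (∀ x → 0ℚ ≤ f x) → 0ℚ ≤ ∑ xs f
  ∑-nonNeg xs 0≤f = ℚ.≤-trans (ℚ.≤-reflexive (sym (∑-0 xs))) (∑-mono-≤ xs 0≤f)

  ∑-filter : ∀ (xs : List A) p f → ∑ (filterᵇ p xs) f ≡ ∑[ x ∈ xs ] (if p x then f x else 0ℚ)
  ∑-filter []       p f = refl
  ∑-filter (x ∷ xs) p f with p x
  ... | true  = cong (f x +_) (∑-filter xs p f)
  ... | false = trans (∑-filter xs p f) (sym (ℚ.+-identityˡ _))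

  ∑-if-float : ∀ p (xs : List A) (f : A → ℚ) →
    (if p then ∑ xs f else 0ℚ) ≡ ∑[ x ∈ xs ] (if p then f x else 0ℚ)
  ∑-if-float true  xs f = refl
  ∑-if-float false xs f = sym (∑-0 xs)

module _ {A B : Set} where

  ∑-map : ∀ (xs : List A) (h : A → B) f → ∑ (map h xs) f ≡ ∑ xs (f ∘ h)
  ∑-map []       h f = refl
  ∑-map (x ∷ xs) h f = cong (f (h x) +_) (∑-map xs h f)

  ∑-concatMap : ∀ (h : A → List B) xs f → ∑ (concatMap h xs) f ≡ ∑[ x ∈ xs ] ∑ (h x) f
  ∑-concatMap h []       f = refl
  ∑-concatMap h (x ∷ xs) f =
    trans (∑-++ (h x) (concatMap h xs) f) (cong (∑ (h x) f +_) (∑-concatMap h xs f))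

  ∑-comm : ∀ (xs : List A) (ys : List B) (f : A → B → ℚ) →
    ∑[ x ∈ xs ] ∑[ y ∈ ys ] f x y ≡ ∑[ y ∈ ys ] ∑[ x ∈ xs ] f x y
  ∑-comm []       ys f = sym (∑-0 ys)
  ∑-comm (x ∷ xs) ys f =
    trans (cong (∑ ys (f x) +_) (∑-comm xs ys f)) (sym (∑-+ ys (f x) (λ y → ∑[ x ∈ xs ] f x y)))

covariance : {A : Set} → List A → (A → ℚ) → (A → ℚ) → ℚ
covariance xs F G = card xs * ∑[ x ∈ xs ] (F x * G x) - ∑ xs F * ∑ xs G

module _ {A : Set} (xs : List A) (F G : A → ℚ) where

  covariance-comm : covariance xs F G ≡ covariance xs G F
  covariance-comm = cong₂ (λ p q → card xs * p - q)
    (∑-cong xs (λ x → ℚ.*-comm (F x) (G x))) (ℚ.*-comm (∑ xs F) (∑ xs G))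

  covariance-flipʳ : ∀ c → covariance xs F (λ x → c - G x) ≡ - covariance xs F G
  covariance-flipʳ c = begin
    card xs * ∑[ x ∈ xs ] (F x * (c - G x)) - ∑ xs F * ∑[ x ∈ xs ] (c - G x)
      ≡⟨ cong₂ (λ p q → card xs * p - ∑ xs F * q)
           (trans (∑-cong xs (λ x → distrib (F x) c (G x)))
                  (trans (∑-difference xs (λ x → c * F x) (λ x → F x * G x)) (cong (_- ∑FG) (∑-*ˡ xs c F))))
           (trans (∑-difference xs (const c) G) (cong (_- ∑ xs G) (∑-const xs c))) ⟩
    card xs * (c * ∑ xs F - ∑FG) - ∑ xs F * (c * card xs - ∑ xs G)
      ≡⟨ identity (card xs) (∑ xs F) (∑ xs G) ∑FG c ⟩
    - covariance xs F G ∎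
    where
    open ≡-Reasoning
    ∑FG : ℚ
    ∑FG = ∑[ x ∈ xs ] (F x * G x)
    distrib : ∀ p c q → p * (c - q) ≡ c * p - p * q
    distrib = solve 3 (λ p c q → p :* (c :- q) := c :* p :- p :* q) refl
    identity : ∀ n sF sG sFG c → n * (c * sF - sFG) - sF * (c * n - sG) ≡ - (n * sFG - sF * sG)
    identity = solve 5 (λ n sF sG sFG c →
      n :* (c :* sF :- sFG) :- sF :* (c :* n :- sG) := :- (n :* sFG :- sF :* sG)) refl

covariance-flipˡ : ∀ {A : Set} (xs : List A) F G c → covariance xs (λ x → c - F x) G ≡ - covariance xs F G
covariance-flipˡ xs F G c = trans (covariance-comm xs (λ x → c - F x) G)
  (trans (covariance-flipʳ xs G F c) (cong -_ (covariance-comm xs G F)))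

-- Harris inequality

Harris : {X : Set} → (X → X → Set) → List X → Set
Harris _≼_ xs = ∀ F G → Monotonic₁ _≼_ _≤_ F → Monotonic₁ _≼_ _≤_ G →
  ∑ xs F * ∑ xs G ≤ card xs * ∑[ x ∈ xs ] (F x * G x)

rearrangement : ∀ {u u′ v v′} → u ≤ u′ → v ≤ v′ → u * v′ + u′ * v ≤ u * v + u′ * v′
rearrangement {u} {u′} {v} {v′} u≤u′ v≤v′ = 0≤q-p⇒p≤q (begin
  0ℚ                                   ≤⟨ *-nonNeg (p≤q⇒0≤q-p u≤u′) (p≤q⇒0≤q-p v≤v′) ⟩
  (u′ - u) * (v′ - v)                  ≡⟨ identity u u′ v v′ ⟩
  u * v + u′ * v′ - (u * v′ + u′ * v)  ∎)
  where
  open ℚ.≤-Reasoning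
  identity : ∀ u u′ v v′ → (u′ - u) * (v′ - v) ≡ u * v + u′ * v′ - (u * v′ + u′ * v)
  identity = solve 4 (λ u u′ v v′ → (u′ :- u) :* (v′ :- v) := u :* v :+ u′ :* v′ :- (u :* v′ :+ u′ :* v)) refl

module _ {A : Set} (xs : List A) (F G : A → ℚ) where
  open ≡-Reasoning

  ∑∑-cross : ∑[ x ∈ xs ] ∑[ y ∈ xs ] (F x * G y + F y * G x) ≡ ∑ xs F * ∑ xs G + ∑ xs F * ∑ xs G
  ∑∑-cross = begin
    ∑[ x ∈ xs ] ∑[ y ∈ xs ] (F x * G y + F y * G x)
      ≡⟨ ∑-cong xs (λ x → trans (∑-+ xs (λ y → F x * G y) (λ y → F y * G x))
                                (cong₂ _+_ (∑-*ˡ xs (F x) G) (∑-*ʳ xs (G x) F))) ⟩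
    ∑[ x ∈ xs ] (F x * ∑ xs G + ∑ xs F * G x)
      ≡⟨ ∑-+ xs (λ x → F x * ∑ xs G) (λ x → ∑ xs F * G x) ⟩
    (∑[ x ∈ xs ] (F x * ∑ xs G)) + (∑[ x ∈ xs ] (∑ xs F * G x))
      ≡⟨ cong₂ _+_ (∑-*ʳ xs (∑ xs G) F) (∑-*ˡ xs (∑ xs F) G) ⟩
    ∑ xs F * ∑ xs G + ∑ xs F * ∑ xs G ∎

  ∑∑-diagonal : ∑[ x ∈ xs ] ∑[ y ∈ xs ] (F x * G x + F y * G y)
              ≡ card xs * ∑[ x ∈ xs ] (F x * G x) + card xs * ∑[ x ∈ xs ] (F x * G x)
  ∑∑-diagonal = begin
    ∑[ x ∈ xs ] ∑[ y ∈ xs ] (FG x + FG y)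
      ≡⟨ ∑-cong xs (λ x → trans (∑-+ xs (const (FG x)) FG) (cong (_+ ∑ xs FG) (∑-const xs (FG x)))) ⟩
    ∑[ x ∈ xs ] (FG x * card xs + ∑ xs FG)
      ≡⟨ ∑-+ xs (λ x → FG x * card xs) (const (∑ xs FG)) ⟩
    (∑[ x ∈ xs ] (FG x * card xs)) + (∑[ _ ∈ xs ] (∑ xs FG))
      ≡⟨ cong₂ _+_ (∑-*ʳ xs (card xs) FG) (∑-const xs (∑ xs FG)) ⟩
    ∑ xs FG * card xs + ∑ xs FG * card xs
      ≡⟨ cong (λ p → p + p) (ℚ.*-comm (∑ xs FG) (card xs)) ⟩
    card xs * ∑ xs FG + card xs * ∑ xs FG ∎
    where
    FG : A → ℚ
    FG x = F x * G x

harris-total : ∀ {X : Set} {_≼_ : X → X → Set} → Total _≼_ → ∀ xs → Harris _≼_ xs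
harris-total total xs F G F-mono G-mono = half-cancel-≤ (begin
  ∑ xs F * ∑ xs G + ∑ xs F * ∑ xs G                ≡⟨ sym (∑∑-cross xs F G) ⟩
  ∑[ x ∈ xs ] ∑[ y ∈ xs ] (F x * G y + F y * G x)  ≤⟨ ∑-mono-≤ xs (λ x → ∑-mono-≤ xs (pairwise x)) ⟩
  ∑[ x ∈ xs ] ∑[ y ∈ xs ] (F x * G x + F y * G y)  ≡⟨ ∑∑-diagonal xs F G ⟩
  card xs * ∑FG + card xs * ∑FG                    ∎)
  where
  open ℚ.≤-Reasoning
  ∑FG : ℚ
  ∑FG = ∑[ x ∈ xs ] (F x * G x)

  pairwise : ∀ x y → F x * G y + F y * G x ≤ F x * G x + F y * G y
  pairwise x y with total x y
  ... | inj₁ x≼y = rearrangement (F-mono x≼y) (G-mono x≼y)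
  ... | inj₂ y≼x = begin
    F x * G y + F y * G x  ≡⟨ ℚ.+-comm (F x * G y) (F y * G x) ⟩
    F y * G x + F x * G y  ≤⟨ rearrangement (F-mono y≼x) (G-mono y≼x) ⟩
    F y * G y + F x * G x  ≡⟨ ℚ.+-comm (F y * G y) (F x * G x) ⟩
    F x * G x + F y * G y  ∎

harris-∑∑ : ∀ {X Y : Set} {R : X → X → Set} {S : Y → Y → Set} {xs ys} →
  Reflexive R → Reflexive S → Harris R xs → Harris S ys →
  ∀ (F G : X → Y → ℚ) → Monotonic₂ R S _≤_ F → Monotonic₂ R S _≤_ G →
  (∑[ x ∈ xs ] ∑ ys (F x)) * (∑[ x ∈ xs ] ∑ ys (G x))
    ≤ (∑[ _ ∈ xs ] card ys) * ∑[ x ∈ xs ] ∑[ y ∈ ys ] (F x y * G x y)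
harris-∑∑ {X} {xs = xs} {ys} R-refl S-refl harris-xs harris-ys F G F-mono G-mono = begin
  ∑ xs ∑F * ∑ xs ∑G
    ≤⟨ harris-xs ∑F ∑G (λ r → ∑-mono-≤ ys (λ y → F-mono r S-refl))
                       (λ r → ∑-mono-≤ ys (λ y → G-mono r S-refl)) ⟩
  card xs * ∑[ x ∈ xs ] (∑F x * ∑G x)
    ≤⟨ *-monoˡ-≤ (∑-nonNeg xs (λ _ → 0≤1))
         (∑-mono-≤ xs (λ x → harris-ys (F x) (G x) (F-mono R-refl) (G-mono R-refl))) ⟩
  card xs * ∑[ x ∈ xs ] (card ys * ∑FG x)
    ≡⟨ cong (card xs *_) (∑-*ˡ xs (card ys) ∑FG) ⟩
  card xs * (card ys * ∑ xs ∑FG)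
    ≡⟨ sym (ℚ.*-assoc (card xs) (card ys) (∑ xs ∑FG)) ⟩
  card xs * card ys * ∑ xs ∑FG
    ≡⟨ cong (_* ∑ xs ∑FG) (trans (ℚ.*-comm (card xs) (card ys)) (sym (∑-const xs (card ys)))) ⟩
  (∑[ _ ∈ xs ] card ys) * ∑ xs ∑FG ∎
  where
  open ℚ.≤-Reasoning
  ∑F ∑G ∑FG : X → ℚ
  ∑F x = ∑ ys (F x)
  ∑G x = ∑ ys (G x)
  ∑FG x = ∑[ y ∈ ys ] (F x y * G x y)

Extensional : ∀ {n K} → ((Fin n → Fin K) → ℚ) → Set
Extensional φ = Monotonic₁ (Pointwise _≡_) _≡_ φ

∑-allFuns-suc : ∀ {n k} (φ : (Fin (suc n) → Fin k) → ℚ) → Extensional φ →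
  ∑ (allFuns (suc n) k) φ ≡ ∑[ c ∈ List.allFin k ] ∑[ f ∈ allFuns n k ] φ (c VF.∷ f)
∑-allFuns-suc {n} {k} φ φ-ext = trans (∑-concatMap _ (List.allFin k) φ)
  (∑-cong (List.allFin k) (λ c → trans (∑-map (allFuns n k) _ φ)
    (∑-cong (allFuns n k) (λ f → φ-ext λ { zero → refl ; (suc i) → refl }))))

monotone⇒extensional : ∀ {n k} {R : Fin k → Fin k → Set} → Reflexive R → (φ : (Fin n → Fin k) → ℚ) →
  Monotonic₁ (Pointwise R) _≤_ φ → Extensional φ
monotone⇒extensional {R = R} R-refl φ φ-mono {f} {g} f≗g =
  ℚ.≤-antisym (φ-mono (λ i → subst (R (f i)) (f≗g i) R-refl))
              (φ-mono (λ i → subst (λ c → R c (f i)) (f≗g i) R-refl))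

harris-allFuns : ∀ {k} {R : Fin k → Fin k → Set} → Reflexive R → Total R →
  ∀ n → Harris (Pointwise R) (allFuns n k)
harris-allFuns {k} R-refl R-total zero = harris-total (λ _ _ → inj₁ (λ ())) (allFuns zero k)
harris-allFuns {k} {R} R-refl R-total (suc n) F G F-mono G-mono = begin
  ∑ (allFuns (suc n) k) F * ∑ (allFuns (suc n) k) G
    ≡⟨ cong₂ _*_ (∑-allFuns-suc F F-ext) (∑-allFuns-suc G G-ext) ⟩
  (∑[ c ∈ cs ] ∑[ f ∈ fs ] F (c VF.∷ f)) * (∑[ c ∈ cs ] ∑[ f ∈ fs ] G (c VF.∷ f))
    ≤⟨ harris-∑∑ {R = R} {S = Pointwise R} {cs} {fs} R-refl (λ _ → R-refl)
         (harris-total R-total cs) (harris-allFuns R-refl R-total n)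
         (λ c f → F (c VF.∷ f)) (λ c f → G (c VF.∷ f))
         (λ r rs → F-mono (∷-mono r rs)) (λ r rs → G-mono (∷-mono r rs)) ⟩
  (∑[ _ ∈ cs ] card fs) * ∑[ c ∈ cs ] ∑[ f ∈ fs ] (F (c VF.∷ f) * G (c VF.∷ f))
    ≡⟨ sym (cong₂ _*_ (∑-allFuns-suc {n} {k} (const 1ℚ) (λ _ → refl))
                     (∑-allFuns-suc (λ f → F f * G f) (λ f≗g → cong₂ _*_ (F-ext f≗g) (G-ext f≗g)))) ⟩
  card (allFuns (suc n) k) * ∑[ f ∈ allFuns (suc n) k ] (F f * G f) ∎
  where
  open ℚ.≤-Reasoning
  cs : List (Fin k)
  cs = List.allFin k
  fs : List (Fin n → Fin k)
  fs = allFuns n k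
  F-ext : Extensional F
  F-ext = monotone⇒extensional {R = R} R-refl F F-mono
  G-ext : Extensional G
  G-ext = monotone⇒extensional {R = R} R-refl G G-mono
  ∷-mono : ∀ {c c′ f f′} → R c c′ → Pointwise R {n} f f′ → Pointwise R (c VF.∷ f) (c′ VF.∷ f′)
  ∷-mono r rs zero    = r
  ∷-mono r rs (suc i) = rs i

fromℕ : ℕ → ℚ
fromℕ zero    = 0ℚ
fromℕ (suc n) = 1ℚ + fromℕ n

fromℕ-nonNeg : ∀ n → 0ℚ ≤ fromℕ n
fromℕ-nonNeg zero    = ℚ.≤-refl
fromℕ-nonNeg (suc n) = +-nonNeg 0≤1 (fromℕ-nonNeg n)

0<1+fromℕ : ∀ n → 0ℚ < 1ℚ + fromℕ n
0<1+fromℕ n = ℚ.<-≤-trans (ℚ.positive⁻¹ 1ℚ) (p≤p+q 1ℚ (fromℕ-nonNeg n))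

fromℕ-mono : ∀ {m n} → m ℕ.≤ n → fromℕ m ≤ fromℕ n
fromℕ-mono {n = n} ℕ.z≤n = fromℕ-nonNeg n
fromℕ-mono (ℕ.s≤s m≤n)   = ℚ.+-monoʳ-≤ 1ℚ (fromℕ-mono m≤n)

fromℕ-+ : ∀ m n → fromℕ (m ℕ.+ n) ≡ fromℕ m + fromℕ n
fromℕ-+ zero    n = sym (ℚ.+-identityˡ (fromℕ n))
fromℕ-+ (suc m) n = trans (cong (1ℚ +_) (fromℕ-+ m n)) (sym (ℚ.+-assoc 1ℚ (fromℕ m) (fromℕ n)))

fromℕ-* : ∀ m n → fromℕ (m ℕ.* n) ≡ fromℕ m * fromℕ n
fromℕ-* zero    n = sym (ℚ.*-zeroˡ (fromℕ n))
fromℕ-* (suc m) n = begin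
  fromℕ (n ℕ.+ m ℕ.* n)        ≡⟨ trans (fromℕ-+ n (m ℕ.* n)) (cong (fromℕ n +_) (fromℕ-* m n)) ⟩
  fromℕ n + fromℕ m * fromℕ n  ≡⟨ cong (_+ fromℕ m * fromℕ n) (sym (ℚ.*-identityˡ (fromℕ n))) ⟩
  1ℚ * fromℕ n + fromℕ m * fromℕ n  ≡⟨ sym (ℚ.*-distribʳ-+ (fromℕ n) 1ℚ (fromℕ m)) ⟩
  (1ℚ + fromℕ m) * fromℕ n     ∎
  where open ≡-Reasoning

^-nonNeg : ∀ {x} → 0ℚ ≤ x → ∀ k → 0ℚ ≤ x ^ k
^-nonNeg 0≤x zero    = 0≤1
^-nonNeg 0≤x (suc k) = *-nonNeg 0≤x (^-nonNeg 0≤x k)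

^-pos : ∀ {x} → 0ℚ < x → ∀ k → 0ℚ < x ^ k
^-pos     0<x zero    = ℚ.positive⁻¹ 1ℚ
^-pos {x} 0<x (suc k) = ℚ.≤-<-trans (ℚ.≤-reflexive (sym (ℚ.*-zeroʳ x)))
                                    (ℚ.*-monoʳ-<-pos x {{ℚ.positive 0<x}} (^-pos 0<x k))

^-+ : ∀ x m n → x ^ (m ℕ.+ n) ≡ x ^ m * x ^ n
^-+ x zero    n = sym (ℚ.*-identityˡ (x ^ n))
^-+ x (suc m) n = trans (cong (x *_) (^-+ x m n)) (sym (ℚ.*-assoc x (x ^ m) (x ^ n)))

1^ : ∀ k → 1ℚ ^ k ≡ 1ℚ
1^ zero    = refl
1^ (suc k) = trans (ℚ.*-identityˡ (1ℚ ^ k)) (1^ k)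

1≤^ : ∀ {x} → 1ℚ ≤ x → ∀ k → 1ℚ ≤ x ^ k
1≤^ 1≤x zero    = ℚ.≤-refl
1≤^ 1≤x (suc k) = *-mono-≤ (ℚ.≤-trans 0≤1 1≤x) 0≤1 1≤x (1≤^ 1≤x k)

^≤1 : ∀ {x} → 0ℚ ≤ x → x ≤ 1ℚ → ∀ k → x ^ k ≤ 1ℚ
^≤1 0≤x x≤1 zero    = ℚ.≤-refl
^≤1 0≤x x≤1 (suc k) = *-mono-≤ 0≤1 (^-nonNeg 0≤x k) x≤1 (^≤1 0≤x x≤1 k)

^-monoʳ-≤ : ∀ {x} → 1ℚ ≤ x → ∀ {k k′} → k ℕ.≤ k′ → x ^ k ≤ x ^ k′
^-monoʳ-≤ 1≤x {k′ = k′} ℕ.z≤n = 1≤^ 1≤x k′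
^-monoʳ-≤ 1≤x (ℕ.s≤s k≤k′)   = *-monoˡ-≤ (ℚ.≤-trans 0≤1 1≤x) (^-monoʳ-≤ 1≤x k≤k′)

^-antimonoʳ-≤ : ∀ {x} → 0ℚ ≤ x → x ≤ 1ℚ → ∀ {k k′} → k ℕ.≤ k′ → x ^ k′ ≤ x ^ k
^-antimonoʳ-≤ 0≤x x≤1 {k′ = k′} ℕ.z≤n = ^≤1 0≤x x≤1 k′
^-antimonoʳ-≤ 0≤x x≤1 (ℕ.s≤s k≤k′)   = *-monoˡ-≤ 0≤x (^-antimonoʳ-≤ 0≤x x≤1 k≤k′)

fromℕ≡mkℚ : ∀ n → fromℕ n ≡ mkℚ (ℤ.+ n) 0 (Coprimality.sym (Coprimality.1-coprimeTo n))
fromℕ≡mkℚ zero    = refl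
fromℕ≡mkℚ (suc n) = trans (cong (1ℚ +_) (fromℕ≡mkℚ n))
  (trans (ℚ./-cong {p₂ = ℤ.+ suc n} {q₂ = 1} (cong (λ z → ℤ.1ℤ ℤ.+ z) (ℤ.*-identityʳ (ℤ.+ n))) refl)
         (ℚ.↥p/↧p≡p _))

≤-fromℕ-∣↥∣ : ∀ q → q ≤ fromℕ ℤ.∣ ℚ.↥ q ∣
≤-fromℕ-∣↥∣ q = ℚ.≤-trans (≤-mkℚ q) (ℚ.≤-reflexive (sym (fromℕ≡mkℚ _)))
  where
  ≤-mkℚ : ∀ q → q ≤ mkℚ (ℤ.+ ℤ.∣ ℚ.↥ q ∣) 0 (Coprimality.sym (Coprimality.1-coprimeTo _))
  ≤-mkℚ (mkℚ (ℤ.+ n) d _)    = ℚ.*≤* (ℤ.*-monoˡ-≤-nonNeg (ℤ.+ n) (ℤ.+≤+ (ℕ.s≤s ℕ.z≤n)))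
  ≤-mkℚ (mkℚ ℤ.-[1+ n ] d _) = ℚ.*≤* (subst (ℤ._≤ (ℤ.+ suc n ℤ.* ℤ.+ suc d))
                                          (sym (ℤ.*-identityʳ ℤ.-[1+ n ]))
                                          (ℤ.-≤+ {n} {suc (d ℕ.+ n ℕ.* suc d)}))

archimedean : ∀ K {δ} → 0ℚ < δ → ∃ λ M → K < fromℕ M * δ
archimedean K {δ} 0<δ = suc M , (begin-strict
  K                  ≡⟨ sym (trans (ℚ.*-assoc K (ℚ.1/ δ) δ)
                                   (trans (cong (K *_) (ℚ.*-inverseˡ δ)) (ℚ.*-identityʳ K))) ⟩
  K * ℚ.1/ δ * δ     ≤⟨ *-monoʳ-≤ (ℚ.<⇒≤ 0<δ) (≤-fromℕ-∣↥∣ (K * ℚ.1/ δ)) ⟩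
  fromℕ M * δ        <⟨ ℚ.*-monoˡ-<-pos δ {{ℚ.positive 0<δ}}
                          (ℚ.≤-<-trans (ℚ.≤-reflexive (sym (ℚ.+-identityˡ (fromℕ M))))
                                       (ℚ.+-monoˡ-< (fromℕ M) (ℚ.positive⁻¹ 1ℚ))) ⟩
  fromℕ (suc M) * δ  ∎)
  where
  open ℚ.≤-Reasoning
  instance
    δ≢0 : ℚ.NonZero δ
    δ≢0 = ℚ.pos⇒nonZero δ {{ℚ.positive 0<δ}}
  M : ℕ
  M = ℤ.∣ ℚ.↥ (K * ℚ.1/ δ) ∣

T-≡ : ∀ {p q} → (T p → T q) → (T q → T p) → p ≡ q
T-≡ {true}  {true}  _   _   = refl
T-≡ {true}  {false} p⇒q _   = ⊥-elim (p⇒q tt)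
T-≡ {false} {true}  _   q⇒p = ⊥-elim (q⇒p tt)
T-≡ {false} {false} _   _   = refl

∧-intro : ∀ {p q} → T p → T q → T (p ∧ q)
∧-intro tp tq = Equivalence.from T-∧ (tp , tq)

∧-elim : ∀ {p q} → T (p ∧ q) → T p × T q
∧-elim = Equivalence.to T-∧

⇒ᵇ-intro : ∀ {p q} → (T p → T q) → T (p ⇒ᵇ q)
⇒ᵇ-intro {true}  q = q tt
⇒ᵇ-intro {false} _ = tt

⇒ᵇ-elim : ∀ {p q} → T (p ⇒ᵇ q) → T p → T q
⇒ᵇ-elim {true} q _ = q

⇒ᵇ-map : ∀ {p q r} → (T q → T r) → T (p ⇒ᵇ q) → T (p ⇒ᵇ r)
⇒ᵇ-map q⇒r t = ⇒ᵇ-intro (q⇒r ∘ ⇒ᵇ-elim t)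

≠ᵇ-intro : ∀ {n} {u v : Fin n} → u ≢ v → T (u ≠ᵇ v)
≠ᵇ-intro = fromWitnessFalse

≠ᵇ-elim : ∀ {n} {u v : Fin n} → T (u ≠ᵇ v) → u ≢ v
≠ᵇ-elim = toWitnessFalse

module _ {A : Set} (p : A → Bool) where

  foldr-∧-intro : ∀ {xs} → All (T ∘ p) xs → T (foldr (λ x r → p x ∧ r) true xs)
  foldr-∧-intro All.[]         = tt
  foldr-∧-intro (px All.∷ pxs) = ∧-intro px (foldr-∧-intro pxs)

  foldr-∧-elim : ∀ xs → T (foldr (λ x r → p x ∧ r) true xs) → All (T ∘ p) xs
  foldr-∧-elim []       _ = All.[]
  foldr-∧-elim (x ∷ xs) t = let px , pxs = ∧-elim t in px All.∷ foldr-∧-elim xs pxs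

allFin-intro : ∀ n {p} → (∀ i → T (p i)) → T (allFin n p)
allFin-intro n {p} ps = foldr-∧-intro p (tabulate⁺ ps)

allFin-elim : ∀ n {p} → T (allFin n p) → ∀ i → T (p i)
allFin-elim n {p} t = tabulate⁻ (foldr-∧-elim p (List.allFin n) t)

allFin-map : ∀ n {p q} → (∀ i → T (p i) → T (q i)) → T (allFin n p) → T (allFin n q)
allFin-map n p⇒q t = allFin-intro n (λ i → p⇒q i (allFin-elim n t i))

length-filterᵇ-mono : ∀ {A : Set} {p q : A → Bool} xs → (∀ x → T (p x) → T (q x)) →
  List.length (filterᵇ p xs) ℕ.≤ List.length (filterᵇ q xs)
length-filterᵇ-mono [] _ = ℕ.z≤n
length-filterᵇ-mono {p = p} {q} (x ∷ xs) p⇒q with p x in px | q x in qx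
... | true  | true  = ℕ.s≤s (length-filterᵇ-mono xs p⇒q)
... | true  | false = ⊥-elim (subst T qx (p⇒q x (subst T (sym px) tt)))
... | false | true  = ℕ.m≤n⇒m≤1+n (length-filterᵇ-mono xs p⇒q)
... | false | false = length-filterᵇ-mono xs p⇒q

count-mono : ∀ n {p q} → (∀ i → T (p i) → T (q i)) → count n p ℕ.≤ count n q
count-mono n = length-filterᵇ-mono (List.allFin n)

count≤n : ∀ n p → count n p ℕ.≤ n
count≤n n p = ℕ.≤-trans (List.length-filter (T? ∘ p) (List.allFin n)) (ℕ.≤-reflexive (List.length-tabulate id))

avoids : ∀ {n N} → Fin N → (Fin n → Fin N) → Bool
avoids {n} t f = allFin n (λ i → f i ≠ᵇ t)

avoids-intro : ∀ {n N} {t : Fin N} {f : Fin n → Fin N} → (∀ i → f i ≢ t) → T (avoids t f)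
avoids-intro {n} f≢t = allFin-intro n (≠ᵇ-intro ∘ f≢t)

avoids-elim : ∀ {n N} {t : Fin N} (f : Fin n → Fin N) → T (avoids t f) → ∀ i → f i ≢ t
avoids-elim {n} f h i = ≠ᵇ-elim (allFin-elim n h i)

allFin-injective-intro : ∀ {n N} {f : Fin n → Fin N} → Injective _≡_ _≡_ f →
  T (allFin n (λ i → allFin n (λ i′ → (i ≠ᵇ i′) ⇒ᵇ (f i ≠ᵇ f i′))))
allFin-injective-intro {n} f-inj =
  allFin-intro n (λ i → allFin-intro n (λ i′ → ⇒ᵇ-intro (λ i≠i′ → ≠ᵇ-intro (≠ᵇ-elim i≠i′ ∘ f-inj))))

allFin-injective-elim : ∀ {n N} {f : Fin n → Fin N} →
  T (allFin n (λ i → allFin n (λ i′ → (i ≠ᵇ i′) ⇒ᵇ (f i ≠ᵇ f i′)))) → Injective _≡_ _≡_ f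
allFin-injective-elim {n} h {i} {i′} fi≡fi′ with i ≟ i′
... | yes i≡i′ = i≡i′
... | no  i≢i′ = ⊥-elim (≠ᵇ-elim (⇒ᵇ-elim (allFin-elim n (allFin-elim n h i) i′) (≠ᵇ-intro i≢i′)) fi≡fi′)

-- Verbatim the test isPerm of Defs, generalised to labels in an arbitrary Fin N.
injectiveᵇ : ∀ {nA nB N} → (Fin nA → Fin N) → (Fin nB → Fin N) → Bool
injectiveᵇ {nA} {nB} f g =
  allFin nA (λ i → allFin nA (λ i′ → (i ≠ᵇ i′) ⇒ᵇ (f i ≠ᵇ f i′)))
  ∧ allFin nB (λ j → allFin nB (λ j′ → (j ≠ᵇ j′) ⇒ᵇ (g j ≠ᵇ g j′)))
  ∧ allFin nA (λ i → allFin nB (λ j → f i ≠ᵇ g j))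

IsInjective : ∀ {nA nB N} → (Fin nA → Fin N) → (Fin nB → Fin N) → Set
IsInjective f g = Injective _≡_ _≡_ f × Injective _≡_ _≡_ g × (∀ i j → f i ≢ g j)

module _ {nA nB N} (f : Fin nA → Fin N) (g : Fin nB → Fin N) where

  injectiveᵇ-intro : IsInjective f g → T (injectiveᵇ f g)
  injectiveᵇ-intro (f-inj , g-inj , f≢g) = ∧-intro (allFin-injective-intro f-inj)
    (∧-intro (allFin-injective-intro g-inj) (allFin-intro nA (λ i → allFin-intro nB (λ j → ≠ᵇ-intro (f≢g i j)))))

  injectiveᵇ-elim : T (injectiveᵇ f g) → IsInjective f g
  injectiveᵇ-elim t =
    let t-f , t-rest = ∧-elim t
        t-g , t-fg   = ∧-elim t-rest
    in allFin-injective-elim t-f , allFin-injective-elim t-g ,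
       (λ i j → ≠ᵇ-elim (allFin-elim nB (allFin-elim nA t-fg i) j))

injectiveᵇ-≡ : ∀ {nA nB N nA′ nB′ N′}
  (f : Fin nA → Fin N) (g : Fin nB → Fin N) (f′ : Fin nA′ → Fin N′) (g′ : Fin nB′ → Fin N′) →
  (IsInjective f g → IsInjective f′ g′) → (IsInjective f′ g′ → IsInjective f g) →
  injectiveᵇ f g ≡ injectiveᵇ f′ g′
injectiveᵇ-≡ f g f′ g′ ⇒ ⇐ =
  T-≡ (injectiveᵇ-intro f′ g′ ∘ ⇒ ∘ injectiveᵇ-elim f g) (injectiveᵇ-intro f g ∘ ⇐ ∘ injectiveᵇ-elim f′ g′)

injectiveᵇ-∘ : ∀ {nA nB N N′} {h : Fin N → Fin N′} → Injective _≡_ _≡_ h →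
  (f : Fin nA → Fin N) (g : Fin nB → Fin N) → injectiveᵇ (h ∘ f) (h ∘ g) ≡ injectiveᵇ f g
injectiveᵇ-∘ {h = h} h-inj f g = injectiveᵇ-≡ (h ∘ f) (h ∘ g) f g
  (λ (hf-inj , hg-inj , hf≢hg) → hf-inj ∘ cong h , hg-inj ∘ cong h , (λ i j → hf≢hg i j ∘ cong h))
  (λ (f-inj , g-inj , f≢g) → f-inj ∘ h-inj , g-inj ∘ h-inj , (λ i j → f≢g i j ∘ h-inj))

injectiveᵇ-comm : ∀ {nA nB N} (f : Fin nA → Fin N) (g : Fin nB → Fin N) → injectiveᵇ f g ≡ injectiveᵇ g f
injectiveᵇ-comm f g = injectiveᵇ-≡ f g g f
  (λ (f-inj , g-inj , f≢g) → g-inj , f-inj , (λ j i → f≢g i j ∘ sym))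
  (λ (g-inj , f-inj , g≢f) → f-inj , g-inj , (λ i j → g≢f j i ∘ sym))

injectiveᵇ-cong : ∀ {nA nB N} {f f′ : Fin nA → Fin N} {g g′ : Fin nB → Fin N} →
  Pointwise _≡_ f f′ → Pointwise _≡_ g g′ → injectiveᵇ f g ≡ injectiveᵇ f′ g′
injectiveᵇ-cong {nA} {nB} {N} {f} {f′} {g} {g′} f≗f′ g≗g′ = injectiveᵇ-≡ f g f′ g′
  (λ (f-inj , g-inj , f≢g) → f-inj ∘ transport f≗f′ , g-inj ∘ transport g≗g′ ,
                            (λ i j → f≢g i j ∘ transport₂ f≗f′ g≗g′))
  (λ (f-inj , g-inj , f≢g) → f-inj ∘ transport (sym ∘ f≗f′) , g-inj ∘ transport (sym ∘ g≗g′) ,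
                            (λ i j → f≢g i j ∘ transport₂ (sym ∘ f≗f′) (sym ∘ g≗g′)))
  where
  transport : ∀ {n} {h h′ : Fin n → Fin N} → Pointwise _≡_ h h′ → ∀ {i i′} → h′ i ≡ h′ i′ → h i ≡ h i′
  transport h≗h′ {i} {i′} e = trans (h≗h′ i) (trans e (sym (h≗h′ i′)))
  transport₂ : ∀ {h h′ : Fin nA → Fin N} {k k′ : Fin nB → Fin N} → Pointwise _≡_ h h′ → Pointwise _≡_ k k′ →
    ∀ {i j} → h′ i ≡ k′ j → h i ≡ k j
  transport₂ h≗h′ k≗k′ {i} {j} e = trans (h≗h′ i) (trans e (sym (k≗k′ j)))

module _ {n N} (c : Fin N) (f : Fin n → Fin N) where

  ∷-injective-elim : Injective _≡_ _≡_ (c VF.∷ f) → (∀ i → f i ≢ c) × Injective _≡_ _≡_ f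
  ∷-injective-elim inj = (λ i fi≡c → case inj {suc i} {zero} fi≡c of λ ()) , Fin.suc-injective ∘ inj

  ∷-injective-intro : (∀ i → f i ≢ c) → Injective _≡_ _≡_ f → Injective _≡_ _≡_ (c VF.∷ f)
  ∷-injective-intro f≢c f-inj {zero}  {zero}   _ = refl
  ∷-injective-intro f≢c f-inj {zero}  {suc i′} e = ⊥-elim (f≢c i′ (sym e))
  ∷-injective-intro f≢c f-inj {suc i} {zero}   e = ⊥-elim (f≢c i e)
  ∷-injective-intro f≢c f-inj {suc i} {suc i′} e = cong suc (f-inj e)

injectiveᵇ-∷ : ∀ {nA nB N} (c : Fin N) (f : Fin nA → Fin N) (g : Fin nB → Fin N) →
  injectiveᵇ (c VF.∷ f) g ≡ (avoids c f ∧ avoids c g) ∧ injectiveᵇ f g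
injectiveᵇ-∷ c f g = T-≡ {injectiveᵇ (c VF.∷ f) g} {(avoids c f ∧ avoids c g) ∧ injectiveᵇ f g}
  (λ t → let (cf-inj , g-inj , cf≢g) = injectiveᵇ-elim (c VF.∷ f) g t
             (f≢c , f-inj) = ∷-injective-elim c f cf-inj
         in ∧-intro (∧-intro (avoids-intro f≢c) (avoids-intro (λ j gj≡c → cf≢g zero j (sym gj≡c))))
                    (injectiveᵇ-intro f g (f-inj , g-inj , cf≢g ∘ suc)))
  (λ t → let (t-avoid , t-inj) = ∧-elim {avoids c f ∧ avoids c g} t
             (f-avoids , g-avoids) = ∧-elim {avoids c f} t-avoid
             (f-inj , g-inj , f≢g) = injectiveᵇ-elim f g t-inj
         in injectiveᵇ-intro (c VF.∷ f) g (∷-injective-intro c f (avoids-elim f f-avoids) f-inj , g-inj ,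
              λ { zero j → avoids-elim g g-avoids j ∘ sym ; (suc i) j → f≢g i j }))

𝟙 : Bool → ℚ
𝟙 p = if p then 1ℚ else 0ℚ

∑-allFin-suc : ∀ {K} (φ : Fin (suc K) → ℚ) → ∑ (List.allFin (suc K)) φ ≡ φ zero + ∑ (List.allFin K) (φ ∘ suc)
∑-allFin-suc {K} φ = cong (φ zero +_)
  (trans (cong (λ xs → ∑ xs φ) (sym (List.map-tabulate id suc))) (∑-map (List.allFin K) suc φ))

card-allFin : ∀ K → card (List.allFin K) ≡ fromℕ K
card-allFin zero    = refl
card-allFin (suc K) = trans (∑-allFin-suc {K} (const 1ℚ)) (cong (1ℚ +_) (card-allFin K))

≟-suc : ∀ {K} (c t : Fin K) → ⌊ suc c ≟ suc t ⌋ ≡ ⌊ c ≟ t ⌋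
≟-suc c t with c ≟ t
... | yes _ = refl
... | no  _ = refl

∑-delta : ∀ {K} (c : Fin K) (φ : Fin K → ℚ) → ∑[ t ∈ List.allFin K ] (if ⌊ c ≟ t ⌋ then φ t else 0ℚ) ≡ φ c
∑-delta {suc K} zero    φ = begin
  ∑[ t ∈ List.allFin (suc K) ] (if ⌊ zero ≟ t ⌋ then φ t else 0ℚ)
    ≡⟨ ∑-allFin-suc (λ t → if ⌊ zero ≟ t ⌋ then φ t else 0ℚ) ⟩
  φ zero + ∑[ _ ∈ List.allFin K ] 0ℚ
    ≡⟨ trans (cong (φ zero +_) (∑-0 (List.allFin K))) (ℚ.+-identityʳ (φ zero)) ⟩
  φ zero ∎
  where open ≡-Reasoning
∑-delta {suc K} (suc c) φ = begin
  ∑[ t ∈ List.allFin (suc K) ] (if ⌊ suc c ≟ t ⌋ then φ t else 0ℚ)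
    ≡⟨ trans (∑-allFin-suc (λ t → if ⌊ suc c ≟ t ⌋ then φ t else 0ℚ)) (ℚ.+-identityˡ _) ⟩
  ∑[ t ∈ List.allFin K ] (if ⌊ suc c ≟ suc t ⌋ then φ (suc t) else 0ℚ)
    ≡⟨ ∑-cong (List.allFin K) (λ t → cong (λ p → if p then φ (suc t) else 0ℚ) (≟-suc c t)) ⟩
  ∑[ t ∈ List.allFin K ] (if ⌊ c ≟ t ⌋ then φ (suc t) else 0ℚ)
    ≡⟨ ∑-delta c (φ ∘ suc) ⟩
  φ (suc c) ∎
  where open ≡-Reasoning

∑-𝟙-remove : ∀ {K} (c : Fin K) (Q : Fin K → Bool) → T (Q c) →
  ∑[ t ∈ List.allFin K ] 𝟙 ((c ≠ᵇ t) ∧ Q t) + 1ℚ ≡ ∑[ t ∈ List.allFin K ] 𝟙 (Q t)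
∑-𝟙-remove {K} c Q Qc = sym (begin
  ∑[ t ∈ ts ] 𝟙 (Q t)
    ≡⟨ ∑-cong ts (λ t → 𝟙-split ⌊ c ≟ t ⌋ (Q t)) ⟩
  ∑[ t ∈ ts ] (𝟙 ((c ≠ᵇ t) ∧ Q t) + 𝟙 (⌊ c ≟ t ⌋ ∧ Q t))
    ≡⟨ ∑-+ ts (λ t → 𝟙 ((c ≠ᵇ t) ∧ Q t)) (λ t → 𝟙 (⌊ c ≟ t ⌋ ∧ Q t)) ⟩
  ∑[ t ∈ ts ] 𝟙 ((c ≠ᵇ t) ∧ Q t) + ∑[ t ∈ ts ] 𝟙 (⌊ c ≟ t ⌋ ∧ Q t)
    ≡⟨ cong (∑[ t ∈ ts ] 𝟙 ((c ≠ᵇ t) ∧ Q t) +_)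
         (trans (∑-cong ts (λ t → if-∧ ⌊ c ≟ t ⌋)) (∑-delta c (𝟙 ∘ Q))) ⟩
  ∑[ t ∈ ts ] 𝟙 ((c ≠ᵇ t) ∧ Q t) + 𝟙 (Q c)
    ≡⟨ cong (λ p → ∑[ t ∈ ts ] 𝟙 ((c ≠ᵇ t) ∧ Q t) + 𝟙 p) (T-≡ {Q c} {true} (const tt) (const Qc)) ⟩
  ∑[ t ∈ ts ] 𝟙 ((c ≠ᵇ t) ∧ Q t) + 1ℚ ∎)
  where
  open ≡-Reasoning
  ts : List (Fin K)
  ts = List.allFin K
  𝟙-split : ∀ p q → 𝟙 q ≡ 𝟙 (not p ∧ q) + 𝟙 (p ∧ q)
  𝟙-split true  q = sym (ℚ.+-identityˡ (𝟙 q))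
  𝟙-split false q = sym (ℚ.+-identityʳ (𝟙 q))

avoids-suc : ∀ {n K} (t : Fin K) (h : Fin (suc n) → Fin K) → avoids t h ≡ (h zero ≠ᵇ t) ∧ avoids t (h ∘ suc)
avoids-suc t h = T-≡ {avoids t h} {(h zero ≠ᵇ t) ∧ avoids t (h ∘ suc)}
  (λ h-avoids → ∧-intro (≠ᵇ-intro (avoids-elim h h-avoids zero)) (avoids-intro (avoids-elim h h-avoids ∘ suc)))
  (λ t′ → let (h0≠t , h′-avoids) = ∧-elim {h zero ≠ᵇ t} t′ in
    avoids-intro λ { zero → ≠ᵇ-elim h0≠t ; (suc i) → avoids-elim (h ∘ suc) h′-avoids i })

avoids-cong : ∀ {n K} (t : Fin K) {h h′ : Fin n → Fin K} → Pointwise _≡_ h h′ → avoids t h ≡ avoids t h′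
avoids-cong t {h} {h′} h≗h′ = T-≡ {avoids t h} {avoids t h′}
  (λ av → avoids-intro (λ i → avoids-elim h av i ∘ trans (h≗h′ i)))
  (λ av → avoids-intro (λ i → avoids-elim h′ av i ∘ trans (sym (h≗h′ i))))

∑-avoids : ∀ {n K} (h : Fin n → Fin K) → Injective _≡_ _≡_ h → (Q : Fin K → Bool) → (∀ i → T (Q (h i))) →
  ∑[ t ∈ List.allFin K ] 𝟙 (avoids t h ∧ Q t) + fromℕ n ≡ ∑[ t ∈ List.allFin K ] 𝟙 (Q t)
∑-avoids {zero}      h _     Q _  = ℚ.+-identityʳ _
∑-avoids {suc n} {K} h h-inj Q hQ = begin
  ∑[ t ∈ ts ] 𝟙 (avoids t h ∧ Q t) + (1ℚ + fromℕ n)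
    ≡⟨ cong (_+ (1ℚ + fromℕ n)) (∑-cong ts (λ t → cong 𝟙
         (trans (cong (_∧ Q t) (avoids-suc t h)) (∧-assoc (h zero ≠ᵇ t) (avoids t (h ∘ suc)) (Q t))))) ⟩
  ∑[ t ∈ ts ] 𝟙 ((h zero ≠ᵇ t) ∧ Q′ t) + (1ℚ + fromℕ n)
    ≡⟨ sym (ℚ.+-assoc (∑[ t ∈ ts ] 𝟙 ((h zero ≠ᵇ t) ∧ Q′ t)) 1ℚ (fromℕ n)) ⟩
  ∑[ t ∈ ts ] 𝟙 ((h zero ≠ᵇ t) ∧ Q′ t) + 1ℚ + fromℕ n
    ≡⟨ cong (_+ fromℕ n) (∑-𝟙-remove (h zero) Q′ (∧-intro (avoids-intro h-suc≢h-zero) (hQ zero))) ⟩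
  ∑[ t ∈ ts ] 𝟙 (Q′ t) + fromℕ n
    ≡⟨ ∑-avoids (h ∘ suc) (Fin.suc-injective ∘ h-inj) Q (hQ ∘ suc) ⟩
  ∑[ t ∈ ts ] 𝟙 (Q t) ∎
  where
  open ≡-Reasoning
  ts : List (Fin K)
  ts = List.allFin K
  Q′ : Fin K → Bool
  Q′ t = avoids t (h ∘ suc) ∧ Q t
  h-suc≢h-zero : ∀ i → h (suc i) ≢ h zero
  h-suc≢h-zero i e = case h-inj e of λ ()

∑-avoids₂ : ∀ {nA nB K} {f : Fin nA → Fin K} {g : Fin nB → Fin K} → IsInjective f g →
  ∑[ t ∈ List.allFin K ] 𝟙 (avoids t f ∧ avoids t g) + fromℕ (nA ℕ.+ nB) ≡ fromℕ K
∑-avoids₂ {nA} {nB} {K} {f} {g} (f-inj , g-inj , f≢g) = begin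
  avoided + fromℕ (nA ℕ.+ nB)
    ≡⟨ trans (cong (avoided +_) (fromℕ-+ nA nB)) (sym (ℚ.+-assoc avoided (fromℕ nA) (fromℕ nB))) ⟩
  avoided + fromℕ nA + fromℕ nB
    ≡⟨ cong (_+ fromℕ nB) (∑-avoids f f-inj (λ t → avoids t g) (λ i → avoids-intro (λ j → f≢g i j ∘ sym))) ⟩
  ∑[ t ∈ ts ] 𝟙 (avoids t g) + fromℕ nB
    ≡⟨ cong (_+ fromℕ nB) (∑-cong ts (λ t → cong 𝟙 (sym (∧-identityʳ (avoids t g))))) ⟩
  ∑[ t ∈ ts ] 𝟙 (avoids t g ∧ true) + fromℕ nB
    ≡⟨ ∑-avoids g g-inj (const true) (const tt) ⟩
  card ts
    ≡⟨ card-allFin K ⟩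
  fromℕ K ∎
  where
  open ≡-Reasoning
  ts : List (Fin K)
  ts = List.allFin K
  avoided : ℚ
  avoided = ∑[ t ∈ ts ] 𝟙 (avoids t f ∧ avoids t g)

∑-avoided : ∀ {nA nB K} (f : Fin nA → Fin K) (g : Fin nB → Fin K) (x : ℚ) →
  ∑[ t ∈ List.allFin K ] (if avoids t f ∧ avoids t g then (if injectiveᵇ f g then x else 0ℚ) else 0ℚ)
    ≡ (fromℕ K - fromℕ (nA ℕ.+ nB)) * (if injectiveᵇ f g then x else 0ℚ)
∑-avoided {nA} {nB} {K} f g x with injectiveᵇ f g in inj
... | false = trans (∑-cong (List.allFin K) (λ t → if-0 (avoids t f ∧ avoids t g)))
                    (trans (∑-0 (List.allFin K)) (sym (ℚ.*-zeroʳ (fromℕ K - fromℕ (nA ℕ.+ nB)))))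
  where
  if-0 : ∀ p → (if p then 0ℚ else 0ℚ) ≡ 0ℚ
  if-0 true  = refl
  if-0 false = refl
... | true = begin
  ∑[ t ∈ ts ] (if avoids t f ∧ avoids t g then x else 0ℚ)
    ≡⟨ ∑-cong ts (λ t → if-𝟙 (avoids t f ∧ avoids t g)) ⟩
  ∑[ t ∈ ts ] (𝟙 (avoids t f ∧ avoids t g) * x)
    ≡⟨ ∑-*ʳ ts x (λ t → 𝟙 (avoids t f ∧ avoids t g)) ⟩
  avoided * x
    ≡⟨ cong (_* x) (+-to-∸ {avoided} (∑-avoids₂ (injectiveᵇ-elim f g (subst T (sym inj) tt)))) ⟩
  (fromℕ K - fromℕ (nA ℕ.+ nB)) * x ∎
  where
  open ≡-Reasoning
  ts : List (Fin K)
  ts = List.allFin K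
  avoided : ℚ
  avoided = ∑[ t ∈ ts ] 𝟙 (avoids t f ∧ avoids t g)
  if-𝟙 : ∀ p → (if p then x else 0ℚ) ≡ 𝟙 p * x
  if-𝟙 true  = sym (ℚ.*-identityˡ x)
  if-𝟙 false = sym (ℚ.*-zeroˡ x)
  +-to-∸ : ∀ {p q r} → p + q ≡ r → p ≡ r - q
  +-to-∸ {p} {q} refl = solve 2 (λ p q → p := p :+ q :- q) refl p q

∑-punchIn : ∀ {N} (t : Fin (suc N)) (ψ : Fin (suc N) → ℚ) →
  ∑[ c ∈ List.allFin N ] ψ (punchIn t c) ≡ ∑[ d ∈ List.allFin (suc N) ] (if d ≠ᵇ t then ψ d else 0ℚ)
∑-punchIn {N} zero ψ = begin
  ∑[ c ∈ List.allFin N ] ψ (suc c)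
    ≡⟨ sym (ℚ.+-identityˡ _) ⟩
  0ℚ + ∑[ c ∈ List.allFin N ] ψ (suc c)
    ≡⟨ sym (∑-allFin-suc (λ d → if d ≠ᵇ zero then ψ d else 0ℚ)) ⟩
  ∑[ d ∈ List.allFin (suc N) ] (if d ≠ᵇ zero then ψ d else 0ℚ) ∎
  where open ≡-Reasoning
∑-punchIn {suc N} (suc t) ψ = begin
  ∑[ c ∈ List.allFin (suc N) ] ψ (punchIn (suc t) c)
    ≡⟨ ∑-allFin-suc (ψ ∘ punchIn (suc t)) ⟩
  ψ zero + ∑[ c ∈ List.allFin N ] ψ (suc (punchIn t c))
    ≡⟨ cong (ψ zero +_) (∑-punchIn t (ψ ∘ suc)) ⟩
  ψ zero + ∑[ d ∈ List.allFin (suc N) ] (if d ≠ᵇ t then ψ (suc d) else 0ℚ)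
    ≡⟨ cong (ψ zero +_) (∑-cong (List.allFin (suc N)) (λ d →
         cong (λ p → if not p then ψ (suc d) else 0ℚ) (sym (≟-suc d t)))) ⟩
  ψ zero + ∑[ d ∈ List.allFin (suc N) ] (if suc d ≠ᵇ suc t then ψ (suc d) else 0ℚ)
    ≡⟨ sym (∑-allFin-suc (λ d → if d ≠ᵇ suc t then ψ d else 0ℚ)) ⟩
  ∑[ d ∈ List.allFin (suc (suc N)) ] (if d ≠ᵇ suc t then ψ d else 0ℚ) ∎
  where open ≡-Reasoning

∑-allFuns-punchIn : ∀ n {N} (t : Fin (suc N)) (φ : (Fin n → Fin (suc N)) → ℚ) → Extensional φ →
  ∑[ f ∈ allFuns n N ] φ (punchIn t ∘ f) ≡ ∑[ h ∈ allFuns n (suc N) ] (if avoids t h then φ h else 0ℚ)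
∑-allFuns-punchIn zero    t φ φ-ext = cong (_+ 0ℚ) (φ-ext (λ ()))
∑-allFuns-punchIn (suc n) {N} t φ φ-ext = begin
  ∑[ f ∈ allFuns (suc n) N ] φ (punchIn t ∘ f)
    ≡⟨ ∑-allFuns-suc (φ ∘ (punchIn t ∘_)) (λ f≗g → φ-ext (cong (punchIn t) ∘ f≗g)) ⟩
  ∑[ c ∈ List.allFin N ] ∑[ f ∈ allFuns n N ] φ (punchIn t ∘ (c VF.∷ f))
    ≡⟨ ∑-cong (List.allFin N) (λ c → ∑-cong (allFuns n N) (λ f → φ-ext λ { zero → refl ; (suc i) → refl })) ⟩
  ∑[ c ∈ List.allFin N ] ∑[ f ∈ allFuns n N ] φ (punchIn t c VF.∷ (punchIn t ∘ f))
    ≡⟨ ∑-cong (List.allFin N) (λ c → ∑-allFuns-punchIn n t (λ h → φ (punchIn t c VF.∷ h)) (φ-ext ∘ ∷-ext)) ⟩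
  ∑[ c ∈ List.allFin N ] ψ (punchIn t c)
    ≡⟨ ∑-punchIn t ψ ⟩
  ∑[ d ∈ List.allFin (suc N) ] (if d ≠ᵇ t then ψ d else 0ℚ)
    ≡⟨ ∑-cong (List.allFin (suc N)) (λ d → trans (∑-if-float (d ≠ᵇ t) (allFuns n (suc N)) _)
         (∑-cong (allFuns n (suc N)) (λ h → trans (sym (if-∧ (d ≠ᵇ t)))
           (cong (λ p → if p then φ (d VF.∷ h) else 0ℚ) (sym (avoids-suc t (d VF.∷ h))))))) ⟩
  ∑[ d ∈ List.allFin (suc N) ] ∑[ h ∈ allFuns n (suc N) ] (if avoids t (d VF.∷ h) then φ (d VF.∷ h) else 0ℚ)
    ≡⟨ sym (∑-allFuns-suc (λ h → if avoids t h then φ h else 0ℚ)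
         (λ h≗h′ → cong₂ (λ p x → if p then x else 0ℚ) (avoids-cong t h≗h′) (φ-ext h≗h′))) ⟩
  ∑[ h ∈ allFuns (suc n) (suc N) ] (if avoids t h then φ h else 0ℚ) ∎
  where
  open ≡-Reasoning
  ψ : Fin (suc N) → ℚ
  ψ d = ∑[ h ∈ allFuns n (suc N) ] (if avoids t h then φ (d VF.∷ h) else 0ℚ)
  ∷-ext : ∀ {d} {h h′ : Fin n → Fin (suc N)} → Pointwise _≡_ h h′ → Pointwise _≡_ (d VF.∷ h) (d VF.∷ h′)
  ∷-ext h≗h′ zero    = refl
  ∷-ext h≗h′ (suc i) = h≗h′ i

card-allFuns : ∀ n N → card (allFuns n N) ≡ fromℕ N ^ n
card-allFuns zero    N = ℚ.+-identityʳ 1ℚ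
card-allFuns (suc n) N = begin
  card (allFuns (suc n) N)                   ≡⟨ ∑-allFuns-suc {n} {N} (const 1ℚ) (λ _ → refl) ⟩
  ∑[ c ∈ List.allFin N ] card (allFuns n N)  ≡⟨ ∑-cong (List.allFin N) (λ _ → card-allFuns n N) ⟩
  ∑[ c ∈ List.allFin N ] (fromℕ N ^ n)       ≡⟨ ∑-const (List.allFin N) (fromℕ N ^ n) ⟩
  fromℕ N ^ n * card (List.allFin N)         ≡⟨ cong (fromℕ N ^ n *_) (card-allFin N) ⟩
  fromℕ N ^ n * fromℕ N                      ≡⟨ ℚ.*-comm (fromℕ N ^ n) (fromℕ N) ⟩
  fromℕ N ^ suc n                            ∎
  where open ≡-Reasoning

∑ᴸ ∑ᴵ ∑ᴰ : ∀ nA nB N → ((Fin nA → Fin N) → (Fin nB → Fin N) → ℚ) → ℚ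
∑ᴸ nA nB N φ = ∑[ f ∈ allFuns nA N ] ∑[ g ∈ allFuns nB N ] φ f g
∑ᴵ nA nB N φ = ∑ᴸ nA nB N (λ f g → if injectiveᵇ f g then φ f g else 0ℚ)
∑ᴰ nA nB N φ = ∑ᴸ nA nB N (λ f g → if injectiveᵇ f g then 0ℚ else φ f g)

Extensional₂ : ∀ {nA nB N} → ((Fin nA → Fin N) → (Fin nB → Fin N) → ℚ) → Set
Extensional₂ φ = Monotonic₂ (Pointwise _≡_) (Pointwise _≡_) _≡_ φ

module _ {nA nB N : ℕ} where

  ∑ᴸ-cong : ∀ {φ ψ : (Fin nA → Fin N) → (Fin nB → Fin N) → ℚ} → (∀ f g → φ f g ≡ ψ f g) →
    ∑ᴸ nA nB N φ ≡ ∑ᴸ nA nB N ψ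
  ∑ᴸ-cong φ≗ψ = ∑-cong (allFuns nA N) (λ f → ∑-cong (allFuns nB N) (φ≗ψ f))

  ∑ᴸ-*ˡ : ∀ c (φ : (Fin nA → Fin N) → (Fin nB → Fin N) → ℚ) →
    ∑ᴸ nA nB N (λ f g → c * φ f g) ≡ c * ∑ᴸ nA nB N φ
  ∑ᴸ-*ˡ c φ = trans (∑-cong (allFuns nA N) (λ f → ∑-*ˡ (allFuns nB N) c (φ f))) (∑-*ˡ (allFuns nA N) c _)

  ∑ᴸ-mono-≤ : ∀ {φ ψ} → (∀ f g → φ f g ≤ ψ f g) → ∑ᴸ nA nB N φ ≤ ∑ᴸ nA nB N ψ
  ∑ᴸ-mono-≤ φ≤ψ = ∑-mono-≤ (allFuns nA N) (λ f → ∑-mono-≤ (allFuns nB N) (φ≤ψ f))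

  ∑ᴸ-nonNeg : ∀ {φ} → (∀ f g → 0ℚ ≤ φ f g) → 0ℚ ≤ ∑ᴸ nA nB N φ
  ∑ᴸ-nonNeg 0≤φ = ∑-nonNeg (allFuns nA N) (λ f → ∑-nonNeg (allFuns nB N) (0≤φ f))

  ∑-∑ᴸ-comm : ∀ {K} (X : Fin K → (Fin nA → Fin N) → (Fin nB → Fin N) → ℚ) →
    ∑[ t ∈ List.allFin K ] ∑ᴸ nA nB N (X t) ≡ ∑ᴸ nA nB N (λ f g → ∑[ t ∈ List.allFin K ] X t f g)
  ∑-∑ᴸ-comm {K} X = trans (∑-comm (List.allFin K) (allFuns nA N) _)
    (∑-cong (allFuns nA N) (λ f → ∑-comm (List.allFin K) (allFuns nB N) (λ t → X t f)))

  ∑ᴸ-1 : ∑ᴸ nA nB N (λ _ _ → 1ℚ) ≡ fromℕ N ^ (nA ℕ.+ nB)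
  ∑ᴸ-1 = begin
    ∑[ f ∈ allFuns nA N ] card (allFuns nB N)  ≡⟨ ∑-cong (allFuns nA N) (λ _ → card-allFuns nB N) ⟩
    ∑[ f ∈ allFuns nA N ] (fromℕ N ^ nB)       ≡⟨ ∑-const (allFuns nA N) (fromℕ N ^ nB) ⟩
    fromℕ N ^ nB * card (allFuns nA N)         ≡⟨ cong (fromℕ N ^ nB *_) (card-allFuns nA N) ⟩
    fromℕ N ^ nB * fromℕ N ^ nA                ≡⟨ ℚ.*-comm (fromℕ N ^ nB) (fromℕ N ^ nA) ⟩
    fromℕ N ^ nA * fromℕ N ^ nB                ≡⟨ sym (^-+ (fromℕ N) nA nB) ⟩
    fromℕ N ^ (nA ℕ.+ nB)                      ∎
    where open ≡-Reasoning

  ∑ᴸ-split : ∀ φ → ∑ᴸ nA nB N φ ≡ ∑ᴵ nA nB N φ + ∑ᴰ nA nB N φ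
  ∑ᴸ-split φ = trans (∑ᴸ-cong (λ f g → split (injectiveᵇ f g) (φ f g)))
    (trans (∑-cong (allFuns nA N) (λ f → ∑-+ (allFuns nB N) _ _)) (∑-+ (allFuns nA N) _ _))
    where
    split : ∀ p x → x ≡ (if p then x else 0ℚ) + (if p then 0ℚ else x)
    split true  x = sym (ℚ.+-identityʳ x)
    split false x = sym (ℚ.+-identityˡ x)

  ∑ᴵ-nonNeg : ∀ {φ} → (∀ f g → 0ℚ ≤ φ f g) → 0ℚ ≤ ∑ᴵ nA nB N φ
  ∑ᴵ-nonNeg 0≤φ = ∑ᴸ-nonNeg (λ f g → if-nonNeg (injectiveᵇ f g) (0≤φ f g))
    where
    if-nonNeg : ∀ p {x} → 0ℚ ≤ x → 0ℚ ≤ (if p then x else 0ℚ)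
    if-nonNeg true  0≤x = 0≤x
    if-nonNeg false _   = ℚ.≤-refl

  ∑ᴰ-nonNeg : ∀ {φ} → (∀ f g → 0ℚ ≤ φ f g) → 0ℚ ≤ ∑ᴰ nA nB N φ
  ∑ᴰ-nonNeg 0≤φ = ∑ᴸ-nonNeg (λ f g → if-nonNeg (injectiveᵇ f g) (0≤φ f g))
    where
    if-nonNeg : ∀ p {x} → 0ℚ ≤ x → 0ℚ ≤ (if p then 0ℚ else x)
    if-nonNeg true  _   = ℚ.≤-refl
    if-nonNeg false 0≤x = 0≤x

  ∑ᴰ-≤ : ∀ {φ K} → (∀ f g → φ f g ≤ K) → ∑ᴰ nA nB N φ ≤ K * ∑ᴰ nA nB N (λ _ _ → 1ℚ)
  ∑ᴰ-≤ {φ} {K} φ≤K = ℚ.≤-trans (∑ᴸ-mono-≤ (λ f g → if-≤ (injectiveᵇ f g) (φ≤K f g)))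
    (ℚ.≤-reflexive (∑ᴸ-*ˡ K (λ f g → if injectiveᵇ f g then 0ℚ else 1ℚ)))
    where
    if-≤ : ∀ p {x} → x ≤ K → (if p then 0ℚ else x) ≤ K * (if p then 0ℚ else 1ℚ)
    if-≤ true  _   = ℚ.≤-reflexive (sym (ℚ.*-zeroʳ K))
    if-≤ false x≤K = ℚ.≤-trans x≤K (ℚ.≤-reflexive (sym (ℚ.*-identityʳ K)))

  injectiveᵇ-ext : Extensional₂ {nA} {nB} {N} (λ f g → 𝟙 (injectiveᵇ f g))
  injectiveᵇ-ext f≗f′ g≗g′ = cong 𝟙 (injectiveᵇ-cong f≗f′ g≗g′)

∑ᴸ-punchIn : ∀ {nA nB N} (t : Fin (suc N)) (φ : (Fin nA → Fin (suc N)) → (Fin nB → Fin (suc N)) → ℚ) →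
  Extensional₂ φ →
  ∑ᴸ nA nB N (λ f g → φ (punchIn t ∘ f) (punchIn t ∘ g))
    ≡ ∑ᴸ nA nB (suc N) (λ f g → if avoids t f ∧ avoids t g then φ f g else 0ℚ)
∑ᴸ-punchIn {nA} {nB} {N} t φ φ-ext = begin
  ∑[ f ∈ allFuns nA N ] ∑[ g ∈ allFuns nB N ] φ (punchIn t ∘ f) (punchIn t ∘ g)
    ≡⟨ ∑-cong (allFuns nA N) (λ f → ∑-allFuns-punchIn nB t (φ (punchIn t ∘ f)) (φ-ext (λ _ → refl))) ⟩
  ∑[ f ∈ allFuns nA N ] ∑[ g ∈ allFuns nB (suc N) ] (if avoids t g then φ (punchIn t ∘ f) g else 0ℚ)
    ≡⟨ ∑-comm (allFuns nA N) (allFuns nB (suc N)) _ ⟩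
  ∑[ g ∈ allFuns nB (suc N) ] ∑[ f ∈ allFuns nA N ] (if avoids t g then φ (punchIn t ∘ f) g else 0ℚ)
    ≡⟨ ∑-cong (allFuns nB (suc N)) (λ g → ∑-allFuns-punchIn nA t (λ f → if avoids t g then φ f g else 0ℚ)
         (λ f≗f′ → cong (λ x → if avoids t g then x else 0ℚ) (φ-ext f≗f′ (λ _ → refl)))) ⟩
  ∑[ g ∈ allFuns nB (suc N) ] ∑[ f ∈ allFuns nA (suc N) ]
    (if avoids t f then (if avoids t g then φ f g else 0ℚ) else 0ℚ)
    ≡⟨ ∑-comm (allFuns nB (suc N)) (allFuns nA (suc N)) _ ⟩
  ∑ᴸ nA nB (suc N) (λ f g → if avoids t f then (if avoids t g then φ f g else 0ℚ) else 0ℚ)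
    ≡⟨ ∑ᴸ-cong {nA} {nB} {suc N} (λ f g → sym (if-∧ (avoids t f))) ⟩
  ∑ᴸ nA nB (suc N) (λ f g → if avoids t f ∧ avoids t g then φ f g else 0ℚ) ∎
  where open ≡-Reasoning

∑-∑ᴸ-avoiding : ∀ {nA nB} K (φ : (Fin nA → Fin K) → (Fin nB → Fin K) → ℚ) →
  ∑[ t ∈ List.allFin K ] ∑ᴸ nA nB K (λ f g →
    if avoids t f ∧ avoids t g then (if injectiveᵇ f g then φ f g else 0ℚ) else 0ℚ)
  ≡ (fromℕ K - fromℕ (nA ℕ.+ nB)) * ∑ᴵ nA nB K φ
∑-∑ᴸ-avoiding {nA} {nB} K φ = trans (∑-∑ᴸ-comm X) (trans (∑ᴸ-cong (λ f g → ∑-avoided f g (φ f g)))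
  (∑ᴸ-*ˡ (fromℕ K - fromℕ (nA ℕ.+ nB)) (λ f g → if injectiveᵇ f g then φ f g else 0ℚ)))
  where
  X : Fin K → (Fin nA → Fin K) → (Fin nB → Fin K) → ℚ
  X t f g = if avoids t f ∧ avoids t g then (if injectiveᵇ f g then φ f g else 0ℚ) else 0ℚ

fallingFactorial : ℚ → ℕ → ℚ
fallingFactorial x zero    = 1ℚ
fallingFactorial x (suc k) = (x - fromℕ k) * fallingFactorial x k

∑ᴵ-1-comm : ∀ nA nB N → ∑ᴵ nA nB N (λ _ _ → 1ℚ) ≡ ∑ᴵ nB nA N (λ _ _ → 1ℚ)
∑ᴵ-1-comm nA nB N = trans (∑ᴸ-cong {nA} {nB} {N} (λ f g → cong 𝟙 (injectiveᵇ-comm f g)))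
  (∑-comm (allFuns nA N) (allFuns nB N) (λ f g → 𝟙 (injectiveᵇ g f)))

∑ᴵ-1-suc : ∀ nA nB N →
  ∑ᴵ (suc nA) nB N (λ _ _ → 1ℚ) ≡ (fromℕ N - fromℕ (nA ℕ.+ nB)) * ∑ᴵ nA nB N (λ _ _ → 1ℚ)
∑ᴵ-1-suc nA nB N = begin
  ∑[ f ∈ allFuns (suc nA) N ] ∑[ g ∈ allFuns nB N ] 𝟙 (injectiveᵇ f g)
    ≡⟨ ∑-allFuns-suc (λ f → ∑[ g ∈ allFuns nB N ] 𝟙 (injectiveᵇ f g))
         (λ f≗f′ → ∑-cong (allFuns nB N) (λ g → injectiveᵇ-ext {suc nA} {nB} {N} f≗f′ (λ _ → refl))) ⟩
  ∑[ c ∈ List.allFin N ] ∑ᴸ nA nB N (λ f g → 𝟙 (injectiveᵇ (c VF.∷ f) g))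
    ≡⟨ ∑-cong (List.allFin N) (λ c → ∑ᴸ-cong {nA} {nB} {N} (λ f g →
         trans (cong 𝟙 (injectiveᵇ-∷ c f g)) (if-∧ (avoids c f ∧ avoids c g)))) ⟩
  ∑[ c ∈ List.allFin N ] ∑ᴸ nA nB N (λ f g → if avoids c f ∧ avoids c g then 𝟙 (injectiveᵇ f g) else 0ℚ)
    ≡⟨ ∑-∑ᴸ-avoiding {nA} {nB} N (λ _ _ → 1ℚ) ⟩
  (fromℕ N - fromℕ (nA ℕ.+ nB)) * ∑ᴵ nA nB N (λ _ _ → 1ℚ) ∎
  where open ≡-Reasoning

∑ᴵ-1 : ∀ nA nB N → ∑ᴵ nA nB N (λ _ _ → 1ℚ) ≡ fallingFactorial (fromℕ N) (nA ℕ.+ nB)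
∑ᴵ-1 zero nB N = trans (∑ᴵ-1-comm zero nB N)
  (trans (one-sided nB) (cong (fallingFactorial (fromℕ N)) (ℕ.+-identityʳ nB)))
  where
  one-sided : ∀ n → ∑ᴵ n zero N (λ _ _ → 1ℚ) ≡ fallingFactorial (fromℕ N) (n ℕ.+ zero)
  one-sided zero    = trans (ℚ.+-identityʳ _) (ℚ.+-identityʳ 1ℚ)
  one-sided (suc n) = trans (∑ᴵ-1-suc n zero N) (cong ((fromℕ N - fromℕ (n ℕ.+ zero)) *_) (one-sided n))
∑ᴵ-1 (suc nA) nB N =
  trans (∑ᴵ-1-suc nA nB N) (cong ((fromℕ N - fromℕ (nA ℕ.+ nB)) *_) (∑ᴵ-1 nA nB N))

Statistic : ℕ → ℕ → Set
Statistic nA nB = ∀ {N} → (Fin nA → Fin N) → (Fin nB → Fin N) → ℚ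

OrderInvariant : ∀ {nA nB} → Statistic nA nB → Set
OrderInvariant φ = ∀ {N} (t : Fin (suc N)) f g → φ (punchIn t ∘ f) (punchIn t ∘ g) ≡ φ f g

-- Each injective labelling into [N + 1] avoids N + 1 − m labels t, and deleting t (undoing
-- punchIn t) is a bijection onto the labellings into [N], preserving order-invariant statistics.
∑ᴵ-punchIn : ∀ {nA nB} (φ : Statistic nA nB) → (∀ {N} → Extensional₂ (φ {N})) → OrderInvariant φ →
  ∀ N → fromℕ (suc N) * ∑ᴵ nA nB N φ ≡ (fromℕ (suc N) - fromℕ (nA ℕ.+ nB)) * ∑ᴵ nA nB (suc N) φ
∑ᴵ-punchIn {nA} {nB} φ φ-ext φ-punchIn N = begin
  fromℕ (suc N) * ∑ᴵ nA nB N φ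
    ≡⟨ cong (_* ∑ᴵ nA nB N φ) (sym (card-allFin (suc N))) ⟩
  card ts * ∑ᴵ nA nB N φ
    ≡⟨ trans (ℚ.*-comm (card ts) (∑ᴵ nA nB N φ)) (sym (∑-const ts (∑ᴵ nA nB N φ))) ⟩
  ∑[ t ∈ ts ] ∑ᴵ nA nB N φ
    ≡⟨ ∑-cong ts (λ t → ∑ᴸ-cong (λ f g → sym (ψ-punchIn t f g))) ⟩
  ∑[ t ∈ ts ] ∑ᴸ nA nB N (λ f g → ψ (punchIn t ∘ f) (punchIn t ∘ g))
    ≡⟨ ∑-cong ts (λ t → ∑ᴸ-punchIn t ψ ψ-ext) ⟩
  ∑[ t ∈ ts ] ∑ᴸ nA nB (suc N) (λ f g → if avoids t f ∧ avoids t g then ψ f g else 0ℚ)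
    ≡⟨ ∑-∑ᴸ-avoiding (suc N) φ ⟩
  (fromℕ (suc N) - fromℕ (nA ℕ.+ nB)) * ∑ᴵ nA nB (suc N) φ ∎
  where
  open ≡-Reasoning
  ts : List (Fin (suc N))
  ts = List.allFin (suc N)
  ψ : ∀ {K} → (Fin nA → Fin K) → (Fin nB → Fin K) → ℚ
  ψ f g = if injectiveᵇ f g then φ f g else 0ℚ
  ψ-punchIn : ∀ t f g → ψ (punchIn t ∘ f) (punchIn t ∘ g) ≡ ψ f g
  ψ-punchIn t f g = cong₂ (λ p x → if p then x else 0ℚ)
    (injectiveᵇ-∘ (Fin.punchIn-injective t _ _) f g) (φ-punchIn t f g)
  ψ-ext : Extensional₂ (ψ {suc N})
  ψ-ext f≗f′ g≗g′ = cong₂ (λ p x → if p then x else 0ℚ) (injectiveᵇ-cong f≗f′ g≗g′) (φ-ext f≗f′ g≗g′)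

-- The average of an order-invariant statistic over the injective labellings into [N] is the
-- same for every N ≥ m.
∑ᴵ-ratio : ∀ {nA nB} (φ : Statistic nA nB) → (∀ {N} → Extensional₂ (φ {N})) → OrderInvariant φ →
  ∀ k → let m = nA ℕ.+ nB; N = k ℕ.+ m in
  ∑ᴵ nA nB m (λ _ _ → 1ℚ) * ∑ᴵ nA nB N φ ≡ ∑ᴵ nA nB N (λ _ _ → 1ℚ) * ∑ᴵ nA nB m φ
∑ᴵ-ratio φ φ-ext φ-punchIn zero = refl
∑ᴵ-ratio {nA} {nB} φ φ-ext φ-punchIn (suc k) = *-cancelˡ-≡ 0<d (begin
  d * (P * S (suc N))          ≡⟨ x*[y*z]≡y*[x*z] d P (S (suc N)) ⟩
  P * (d * S (suc N))          ≡⟨ cong (P *_) (sym (∑ᴵ-punchIn φ φ-ext φ-punchIn N)) ⟩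
  P * (fromℕ (suc N) * S N)    ≡⟨ x*[y*z]≡y*[x*z] P (fromℕ (suc N)) (S N) ⟩
  fromℕ (suc N) * (P * S N)    ≡⟨ cong (fromℕ (suc N) *_) (∑ᴵ-ratio φ φ-ext φ-punchIn k) ⟩
  fromℕ (suc N) * (I N * S m)  ≡⟨ sym (ℚ.*-assoc (fromℕ (suc N)) (I N) (S m)) ⟩
  fromℕ (suc N) * I N * S m    ≡⟨ cong (_* S m)
                                    (∑ᴵ-punchIn {nA} {nB} (λ _ _ → 1ℚ) (λ _ _ → refl) (λ _ _ _ → refl) N) ⟩
  d * I (suc N) * S m          ≡⟨ ℚ.*-assoc d (I (suc N)) (S m) ⟩
  d * (I (suc N) * S m)        ∎)
  where
  open ≡-Reasoning
  m N : ℕ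
  m = nA ℕ.+ nB
  N = k ℕ.+ m
  S I : ℕ → ℚ
  S K = ∑ᴵ nA nB K φ
  I K = ∑ᴵ nA nB K (λ _ _ → 1ℚ)
  P d : ℚ
  P = I m
  d = fromℕ (suc N) - fromℕ m
  x*[y*z]≡y*[x*z] : ∀ x y z → x * (y * z) ≡ y * (x * z)
  x*[y*z]≡y*[x*z] = solve 3 (λ x y z → x :* (y :* z) := y :* (x :* z)) refl
  1+x≡1+[x+y]-y : ∀ x y → 1ℚ + x ≡ 1ℚ + (x + y) - y
  1+x≡1+[x+y]-y = solve 2 (λ x y → con 1ℚ :+ x := con 1ℚ :+ (x :+ y) :- y) refl
  0<d : 0ℚ < d
  0<d = ℚ.<-≤-trans (0<1+fromℕ k) (ℚ.≤-reflexive (begin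
    1ℚ + fromℕ k                        ≡⟨ 1+x≡1+[x+y]-y (fromℕ k) (fromℕ m) ⟩
    1ℚ + (fromℕ k + fromℕ m) - fromℕ m  ≡⟨ cong (λ x → 1ℚ + x - fromℕ m) (sym (fromℕ-+ k m)) ⟩
    d                                   ∎))

-- Almost every labelling into [N] is injective

fallingFactorial-≥ : ∀ {N k} → k ℕ.≤ N →
  fromℕ N ^ k * (fromℕ N - fromℕ k * fromℕ k) ≤ fromℕ N * fallingFactorial (fromℕ N) k
fallingFactorial-≥ {N} {zero}  _   = ℚ.≤-reflexive (base (fromℕ N))
  where
  base : ∀ x → 1ℚ * (x - 0ℚ * 0ℚ) ≡ x * 1ℚ
  base = solve 1 (λ x → con 1ℚ :* (x :- con 0ℚ :* con 0ℚ) := x :* con 1ℚ) refl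
fallingFactorial-≥ {N} {suc k} k<N = begin
  X * X ^ k * (X - (1ℚ + y) * (1ℚ + y))
    ≤⟨ 0≤q-p⇒p≤q (ℚ.≤-trans (*-nonNeg (^-nonNeg (fromℕ-nonNeg N) k) slack)
                            (ℚ.≤-reflexive (step X (X ^ k) y))) ⟩
  (X - y) * (X ^ k * (X - y * y))
    ≤⟨ *-monoˡ-≤ (p≤q⇒0≤q-p (fromℕ-mono (ℕ.<⇒≤ k<N))) (fallingFactorial-≥ (ℕ.<⇒≤ k<N)) ⟩
  (X - y) * (X * fallingFactorial X k)
    ≡⟨ x*[y*z]≡y*[x*z] (X - y) X (fallingFactorial X k) ⟩
  X * ((X - y) * fallingFactorial X k) ∎
  where
  open ℚ.≤-Reasoning
  X y : ℚ
  X = fromℕ N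
  y = fromℕ k
  slack : 0ℚ ≤ X * (1ℚ + y) + y * y * y
  slack = +-nonNeg (*-nonNeg (fromℕ-nonNeg N) (fromℕ-nonNeg (suc k)))
                   (*-nonNeg (*-nonNeg (fromℕ-nonNeg k) (fromℕ-nonNeg k)) (fromℕ-nonNeg k))
  step : ∀ X P y → P * (X * (1ℚ + y) + y * y * y)
    ≡ (X - y) * (P * (X - y * y)) - X * P * (X - (1ℚ + y) * (1ℚ + y))
  step = solve 3 (λ X P y → P :* (X :* (con 1ℚ :+ y) :+ y :* y :* y)
    := (X :- y) :* (P :* (X :- y :* y)) :- X :* P :* (X :- (con 1ℚ :+ y) :* (con 1ℚ :+ y))) refl
  x*[y*z]≡y*[x*z] : ∀ x y z → x * (y * z) ≡ y * (x * z)
  x*[y*z]≡y*[x*z] = solve 3 (λ x y z → x :* (y :* z) := y :* (x :* z)) refl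

module _ (m N : ℕ) (m≤N : m ℕ.≤ N) where

  private
    X Nᵐ Nₘ mm : ℚ
    X  = fromℕ N
    Nᵐ = X ^ m
    Nₘ = fallingFactorial X m
    mm = fromℕ m * fromℕ m

  fallingFactorial-≥-half : 0ℚ < X → mm + mm ≤ X → Nᵐ ≤ Nₘ + Nₘ
  fallingFactorial-≥-half 0<X 2mm≤X = ℚ.*-cancelˡ-≤-pos X {{ℚ.positive 0<X}} (begin
    X * Nᵐ                         ≡⟨ ℚ.*-comm X Nᵐ ⟩
    Nᵐ * X                         ≤⟨ *-monoˡ-≤ (^-nonNeg (fromℕ-nonNeg N) m) X≤2[X-mm] ⟩
    Nᵐ * ((X - mm) + (X - mm))     ≡⟨ ℚ.*-distribˡ-+ Nᵐ (X - mm) (X - mm) ⟩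
    Nᵐ * (X - mm) + Nᵐ * (X - mm)  ≤⟨ ℚ.+-mono-≤ (fallingFactorial-≥ m≤N) (fallingFactorial-≥ m≤N) ⟩
    X * Nₘ + X * Nₘ                ≡⟨ sym (ℚ.*-distribˡ-+ X Nₘ Nₘ) ⟩
    X * (Nₘ + Nₘ)                  ∎)
    where
    open ℚ.≤-Reasoning
    identity : ∀ x y → x - (y + y) ≡ (x - y) + (x - y) - x
    identity = solve 2 (λ x y → x :- (y :+ y) := (x :- y) :+ (x :- y) :- x) refl
    X≤2[X-mm] : X ≤ (X - mm) + (X - mm)
    X≤2[X-mm] = 0≤q-p⇒p≤q (ℚ.≤-trans (p≤q⇒0≤q-p 2mm≤X) (ℚ.≤-reflexive (identity X mm)))

  fallingFactorial-deficit : X * (Nᵐ - Nₘ) ≤ mm * Nᵐ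
  fallingFactorial-deficit = begin
    X * (Nᵐ - Nₘ)           ≡⟨ expand X Nᵐ Nₘ ⟩
    X * Nᵐ - X * Nₘ         ≤⟨ ℚ.+-monoʳ-≤ (X * Nᵐ) (ℚ.neg-antimono-≤ (fallingFactorial-≥ m≤N)) ⟩
    X * Nᵐ - Nᵐ * (X - mm)  ≡⟨ cancel X Nᵐ mm ⟩
    mm * Nᵐ                 ∎
    where
    open ℚ.≤-Reasoning
    expand : ∀ x t i → x * (t - i) ≡ x * t - x * i
    expand = solve 3 (λ x t i → x :* (t :- i) := x :* t :- x :* i) refl
    cancel : ∀ x t q → x * t - t * (x - q) ≡ q * t
    cancel = solve 3 (λ x t q → x :* t :- t :* (x :- q) := q :* t) refl

gap-bound : ∀ {X Nᵐ Nₘ δ mm C} → 0ℚ ≤ X → 0ℚ < Nᵐ → 0ℚ ≤ δ → 0ℚ ≤ C →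
  Nᵐ ≤ Nₘ + Nₘ → X * (Nᵐ - Nₘ) ≤ mm * Nᵐ → Nₘ * Nₘ * δ ≤ (Nᵐ - Nₘ) * Nᵐ * C →
  X * δ ≤ fromℕ 4 * mm * C
gap-bound {X} {Nᵐ} {Nₘ} {δ} {mm} {C} 0≤X 0<Nᵐ 0≤δ 0≤C Nᵐ≤2Nₘ deficit gap =
  ℚ.*-cancelˡ-≤-pos (Nᵐ * Nᵐ) {{ℚ.positive 0<Nᵐ²}} (begin
    Nᵐ * Nᵐ * (X * δ)                     ≡⟨ rearrange₁ Nᵐ X δ ⟩
    X * (Nᵐ * Nᵐ * δ)                     ≤⟨ *-monoˡ-≤ 0≤X (*-monoʳ-≤ 0≤δ (*-mono-≤ 0≤2Nₘ 0≤Nᵐ Nᵐ≤2Nₘ Nᵐ≤2Nₘ)) ⟩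
    X * ((Nₘ + Nₘ) * (Nₘ + Nₘ) * δ)       ≡⟨ rearrange₂ X Nₘ δ ⟩
    fromℕ 4 * X * (Nₘ * Nₘ * δ)           ≤⟨ *-monoˡ-≤ (*-nonNeg (fromℕ-nonNeg 4) 0≤X) gap ⟩
    fromℕ 4 * X * ((Nᵐ - Nₘ) * Nᵐ * C)    ≡⟨ rearrange₃ X Nᵐ Nₘ C ⟩
    fromℕ 4 * (Nᵐ * C) * (X * (Nᵐ - Nₘ))  ≤⟨ *-monoˡ-≤ (*-nonNeg (fromℕ-nonNeg 4) (*-nonNeg 0≤Nᵐ 0≤C)) deficit ⟩
    fromℕ 4 * (Nᵐ * C) * (mm * Nᵐ)        ≡⟨ rearrange₄ Nᵐ C mm ⟩
    Nᵐ * Nᵐ * (fromℕ 4 * mm * C)          ∎)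
  where
  open ℚ.≤-Reasoning
  0≤Nᵐ : 0ℚ ≤ Nᵐ
  0≤Nᵐ = ℚ.<⇒≤ 0<Nᵐ
  0≤2Nₘ : 0ℚ ≤ Nₘ + Nₘ
  0≤2Nₘ = ℚ.≤-trans 0≤Nᵐ Nᵐ≤2Nₘ
  0<Nᵐ² : 0ℚ < Nᵐ * Nᵐ
  0<Nᵐ² = ℚ.≤-<-trans (ℚ.≤-reflexive (sym (ℚ.*-zeroʳ Nᵐ))) (ℚ.*-monoʳ-<-pos Nᵐ {{ℚ.positive 0<Nᵐ}} 0<Nᵐ)
  rearrange₁ : ∀ t x d → t * t * (x * d) ≡ x * (t * t * d)
  rearrange₁ = solve 3 (λ t x d → t :* t :* (x :* d) := x :* (t :* t :* d)) refl
  rearrange₂ : ∀ x i d → x * ((i + i) * (i + i) * d) ≡ fromℕ 4 * x * (i * i * d)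
  rearrange₂ = solve 3 (λ x i d → x :* ((i :+ i) :* (i :+ i) :* d) := con (fromℕ 4) :* x :* (i :* i :* d)) refl
  rearrange₃ : ∀ x t i c → fromℕ 4 * x * ((t - i) * t * c) ≡ fromℕ 4 * (t * c) * (x * (t - i))
  rearrange₃ = solve 4 (λ x t i c →
    con (fromℕ 4) :* x :* ((t :- i) :* t :* c) := con (fromℕ 4) :* (t :* c) :* (x :* (t :- i))) refl
  rearrange₄ : ∀ t c q → fromℕ 4 * (t * c) * (q * t) ≡ t * t * (fromℕ 4 * q * c)
  rearrange₄ = solve 3 (λ t c q → con (fromℕ 4) :* (t :* c) :* (q :* t) := t :* t :* (con (fromℕ 4) :* q :* c)) refl

-- Since Nₘ ≥ Nᵐ / 2 and N (Nᵐ − Nₘ) ≤ m² Nᵐ, the hypothesis gives N (P − Q) ≤ 4 m² C for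
-- every large N (gap-bound).
fallingFactorial-limit : ∀ m {P Q C} → 0ℚ ≤ C →
  (∀ k → let X = fromℕ (k ℕ.+ m); Nᵐ = X ^ m; Nₘ = fallingFactorial X m in
     Nₘ * Nₘ * P ≤ Nₘ * Nₘ * Q + (Nᵐ - Nₘ) * Nᵐ * C) →
  P ≤ Q
fallingFactorial-limit m {P} {Q} {C} 0≤C approx with (P - Q) ℚ.≤? 0ℚ
... | yes P-Q≤0 = p-q≤0⇒p≤q P-Q≤0
... | no  P-Q≰0 = ⊥-elim (ℚ.<-irrefl refl (ℚ.<-≤-trans K<Mδ (ℚ.≤-trans Mδ≤Xδ Xδ≤K)))
  where
  δ mm K : ℚ
  δ = P - Q
  mm = fromℕ m * fromℕ m
  K = fromℕ 4 * mm * C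
  0<δ : 0ℚ < δ
  0<δ = ℚ.≰⇒> P-Q≰0
  M : ℕ
  M = proj₁ (archimedean K 0<δ)
  K<Mδ : K < fromℕ M * δ
  K<Mδ = proj₂ (archimedean K 0<δ)
  k N : ℕ
  k = suc M ℕ.+ (m ℕ.* m ℕ.+ m ℕ.* m)
  N = k ℕ.+ m
  X Nₘ : ℚ
  X = fromℕ N
  Nₘ = fallingFactorial X m
  m≤N : m ℕ.≤ N
  m≤N = ℕ.m≤n+m m k
  0<X : 0ℚ < X
  0<X = 0<1+fromℕ (M ℕ.+ (m ℕ.* m ℕ.+ m ℕ.* m) ℕ.+ m)
  Mδ≤Xδ : fromℕ M * δ ≤ X * δ
  Mδ≤Xδ = *-monoʳ-≤ (ℚ.<⇒≤ 0<δ) (fromℕ-mono (ℕ.≤-trans (ℕ.m≤n⇒m≤1+n (ℕ.m≤m+n M _)) (ℕ.m≤m+n k m)))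
  2mm≤X : mm + mm ≤ X
  2mm≤X = ℚ.≤-trans
    (ℚ.≤-reflexive (sym (trans (fromℕ-+ (m ℕ.* m) (m ℕ.* m)) (cong₂ _+_ (fromℕ-* m m) (fromℕ-* m m)))))
    (fromℕ-mono (ℕ.≤-trans (ℕ.m≤n+m _ (suc M)) (ℕ.m≤m+n k m)))
  x*[p-q]≡x*p-x*q : ∀ x p q → x * (p - q) ≡ x * p - x * q
  x*[p-q]≡x*p-x*q = solve 3 (λ x p q → x :* (p :- q) := x :* p :- x :* q) refl
  Xδ≤K : X * δ ≤ K
  Xδ≤K = gap-bound {mm = mm} (fromℕ-nonNeg N) (^-pos 0<X m) (ℚ.<⇒≤ 0<δ) 0≤C
    (fallingFactorial-≥-half m N m≤N 0<X 2mm≤X) (fallingFactorial-deficit m N m≤N)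
    (ℚ.≤-trans (ℚ.≤-reflexive (x*[p-q]≡x*p-x*q (Nₘ * Nₘ) P Q)) (p≤q+r⇒p-q≤r (approx k)))

-- sX: sums over the permutations; SX, RX: over the injective and the degenerate labellings
-- into [N]; P, Nₘ, Nᵐ: the numbers of permutations, injective labellings and all labellings.
approximate-harris : ∀ {P Nₘ Nᵐ K sF sG sFG SF SG SFG RF RG RFG : ℚ} →
  0ℚ ≤ P → 0ℚ ≤ Nₘ → Nₘ ≤ Nᵐ → 0ℚ ≤ sFG → 0ℚ ≤ SF → 0ℚ ≤ SG → 0ℚ ≤ RF → 0ℚ ≤ RG →
  RFG ≤ K * (Nᵐ - Nₘ) → P * SF ≡ Nₘ * sF → P * SG ≡ Nₘ * sG → P * SFG ≡ Nₘ * sFG →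
  (SF + RF) * (SG + RG) ≤ Nᵐ * (SFG + RFG) →
  Nₘ * Nₘ * (sF * sG) ≤ Nₘ * Nₘ * (P * sFG) + (Nᵐ - Nₘ) * Nᵐ * (P * sFG + P * P * K)
approximate-harris {P} {Nₘ} {Nᵐ} {K} {sF} {sG} {sFG} {SF} {SG} {SFG} {RF} {RG} {RFG}
                   0≤P 0≤Nₘ Nₘ≤Nᵐ 0≤sFG 0≤SF 0≤SG 0≤RF 0≤RG RFG≤Kn PSF PSG PSFG harris = begin
  Nₘ * Nₘ * (sF * sG)                        ≡⟨ interchange Nₘ sF sG ⟩
  (Nₘ * sF) * (Nₘ * sG)                      ≡⟨ sym (cong₂ _*_ PSF PSG) ⟩
  (P * SF) * (P * SG)                        ≡⟨ sym (interchange P SF SG) ⟩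
  P * P * (SF * SG)                          ≤⟨ *-monoˡ-≤ 0≤PP (*-mono-≤ (+-nonNeg 0≤SF 0≤RF) 0≤SG
                                                  (p≤p+q SF 0≤RF) (p≤p+q SG 0≤RG)) ⟩
  P * P * ((SF + RF) * (SG + RG))            ≤⟨ *-monoˡ-≤ 0≤PP harris ⟩
  P * P * (Nᵐ * (SFG + RFG))                 ≡⟨ expand P Nᵐ SFG RFG ⟩
  P * Nᵐ * (P * SFG) + P * P * Nᵐ * RFG      ≤⟨ ℚ.+-mono-≤ (ℚ.≤-reflexive (cong (P * Nᵐ *_) PSFG))
                                                  (*-monoˡ-≤ (*-nonNeg 0≤PP 0≤Nᵐ) RFG≤Kn) ⟩
  P * Nᵐ * (Nₘ * sFG) + P * P * Nᵐ * (K * n) ≡⟨ regroup P Nₘ Nᵐ sFG K ⟩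
  Nₘ * Nₘ * (P * sFG) + n * (Nₘ * (P * sFG)) + n * Nᵐ * (P * P * K)
    ≤⟨ ℚ.+-monoˡ-≤ (n * Nᵐ * (P * P * K)) (ℚ.+-monoʳ-≤ (Nₘ * Nₘ * (P * sFG))
         (*-monoˡ-≤ 0≤n (*-monoʳ-≤ (*-nonNeg 0≤P 0≤sFG) Nₘ≤Nᵐ))) ⟩
  Nₘ * Nₘ * (P * sFG) + n * (Nᵐ * (P * sFG)) + n * Nᵐ * (P * P * K)
    ≡⟨ collect Nₘ n Nᵐ (P * sFG) (P * P * K) ⟩
  Nₘ * Nₘ * (P * sFG) + n * Nᵐ * (P * sFG + P * P * K) ∎
  where
  open ℚ.≤-Reasoning
  n : ℚ
  n = Nᵐ - Nₘ
  0≤n : 0ℚ ≤ n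
  0≤n = p≤q⇒0≤q-p Nₘ≤Nᵐ
  0≤PP : 0ℚ ≤ P * P
  0≤PP = *-nonNeg 0≤P 0≤P
  0≤Nᵐ : 0ℚ ≤ Nᵐ
  0≤Nᵐ = ℚ.≤-trans 0≤Nₘ Nₘ≤Nᵐ
  interchange : ∀ x p q → x * x * (p * q) ≡ (x * p) * (x * q)
  interchange = solve 3 (λ x p q → x :* x :* (p :* q) := (x :* p) :* (x :* q)) refl
  expand : ∀ p t s r → p * p * (t * (s + r)) ≡ p * t * (p * s) + p * p * t * r
  expand = solve 4 (λ p t s r → p :* p :* (t :* (s :+ r)) := p :* t :* (p :* s) :+ p :* p :* t :* r) refl
  regroup : ∀ p i t s k → p * t * (i * s) + p * p * t * (k * (t - i))
    ≡ i * i * (p * s) + (t - i) * (i * (p * s)) + (t - i) * t * (p * p * k)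
  regroup = solve 5 (λ p i t s k → p :* t :* (i :* s) :+ p :* p :* t :* (k :* (t :- i))
    := i :* i :* (p :* s) :+ (t :- i) :* (i :* (p :* s)) :+ (t :- i) :* t :* (p :* p :* k)) refl
  collect : ∀ i n t u v → i * i * u + n * (t * u) + n * t * v ≡ i * i * u + n * t * (u + v)
  collect = solve 5 (λ i n t u v → i :* i :* u :+ n :* (t :* u) :+ n :* t :* v := i :* i :* u :+ n :* t :* (u :+ v)) refl

module Activity (H : BipGraph) where

  LabelsA LabelsB : ℕ → Set
  LabelsA N = Fin (a H) → Fin N
  LabelsB N = Fin (b H) → Fin N

  iaᴺ : ∀ {N} → LabelsA N → LabelsB N → ℕ
  iaᴺ f g = count (a H) (λ i → allFin (b H) (λ j → E H i j ⇒ᵇ ⌊ g j <? f i ⌋))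

  eaᴺ : ∀ {N} → LabelsA N → LabelsB N → ℕ
  eaᴺ f g = count (b H) (λ j → allFin (a H) (λ i → E H i j ⇒ᵇ ⌊ f i <? g j ⌋))

  module _ {N N′} {f : LabelsA N} {g : LabelsB N} {f′ : LabelsA N′} {g′ : LabelsB N′} where

    ia-≤ : (∀ i j → g j Fin.< f i → g′ j Fin.< f′ i) → iaᴺ f g ℕ.≤ iaᴺ f′ g′
    ia-≤ below = count-mono (a H) (λ i → allFin-map (b H) (λ j →
      ⇒ᵇ-map {E H i j} (λ t → fromWitness (below i j (toWitness {a? = g j <? f i} t)))))

    ea-≤ : (∀ i j → f i Fin.< g j → f′ i Fin.< g′ j) → eaᴺ f g ℕ.≤ eaᴺ f′ g′
    ea-≤ below = count-mono (b H) (λ j → allFin-map (a H) (λ i →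
      ⇒ᵇ-map {E H i j} (λ t → fromWitness (below i j (toWitness {a? = f i <? g j} t)))))

  module _ {N} {f f′ : LabelsA N} {g g′ : LabelsB N}
           (f≤f′ : Pointwise Fin._≤_ f f′) (g≥g′ : Pointwise (flip Fin._≤_) g g′) where

    ia-mono : iaᴺ f g ℕ.≤ iaᴺ f′ g′
    ia-mono = ia-≤ (λ i j g<f → ℕ.≤-<-trans (g≥g′ j) (ℕ.<-≤-trans g<f (f≤f′ i)))

    ea-antimono : eaᴺ f′ g′ ℕ.≤ eaᴺ f g
    ea-antimono = ea-≤ (λ i j f′<g′ → ℕ.≤-<-trans (f≤f′ i) (ℕ.<-≤-trans f′<g′ (g≥g′ j)))

  module _ {N} {f f′ : LabelsA N} {g g′ : LabelsB N} (f≗f′ : Pointwise _≡_ f f′) (g≗g′ : Pointwise _≡_ g g′) where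

    ia-cong : iaᴺ f g ≡ iaᴺ f′ g′
    ia-cong = ℕ.≤-antisym (ia-≤ (λ i j → subst₂ Fin._<_ (g≗g′ j) (f≗f′ i)))
                          (ia-≤ (λ i j → subst₂ Fin._<_ (sym (g≗g′ j)) (sym (f≗f′ i))))

    ea-cong : eaᴺ f g ≡ eaᴺ f′ g′
    ea-cong = ℕ.≤-antisym (ea-≤ (λ i j → subst₂ Fin._<_ (f≗f′ i) (g≗g′ j)))
                          (ea-≤ (λ i j → subst₂ Fin._<_ (sym (f≗f′ i)) (sym (g≗g′ j))))

  punchIn-mono-< : ∀ {N} (t : Fin (suc N)) {u v : Fin N} → u Fin.< v → punchIn t u Fin.< punchIn t v
  punchIn-mono-< t {u} {v} u<v = ℕ.≰⇒> (λ v′≤u′ → ℕ.<⇒≱ u<v (Fin.punchIn-cancel-≤ t v u v′≤u′))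

  punchIn-cancel-< : ∀ {N} (t : Fin (suc N)) {u v : Fin N} → punchIn t u Fin.< punchIn t v → u Fin.< v
  punchIn-cancel-< t {u} {v} u′<v′ = ℕ.≰⇒> (λ v≤u → ℕ.<⇒≱ u′<v′ (Fin.punchIn-mono-≤ t v u v≤u))

  module _ {N} (t : Fin (suc N)) (f : LabelsA N) (g : LabelsB N) where

    ia-punchIn : iaᴺ (punchIn t ∘ f) (punchIn t ∘ g) ≡ iaᴺ f g
    ia-punchIn = ℕ.≤-antisym (ia-≤ (λ i j → punchIn-cancel-< t)) (ia-≤ (λ i j → punchIn-mono-< t))

    ea-punchIn : eaᴺ (punchIn t ∘ f) (punchIn t ∘ g) ≡ eaᴺ f g
    ea-punchIn = ℕ.≤-antisym (ea-≤ (λ i j → punchIn-cancel-< t)) (ea-≤ (λ i j → punchIn-mono-< t))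

  statistic : (ℕ → ℕ → ℚ) → Statistic (a H) (b H)
  statistic W f g = W (iaᴺ f g) (eaᴺ f g)

  MonotoneWeight : (ℕ → ℕ → ℚ) → Set
  MonotoneWeight W = Monotonic₂ ℕ._≤_ (flip ℕ._≤_) _≤_ W

  module _ (W : ℕ → ℕ → ℚ) where

    statistic-ext : ∀ {N} → Extensional₂ (statistic W {N})
    statistic-ext f≗f′ g≗g′ = cong₂ W (ia-cong f≗f′ g≗g′) (ea-cong f≗f′ g≗g′)

    statistic-punchIn : OrderInvariant (statistic W)
    statistic-punchIn t f g = cong₂ W (ia-punchIn t f g) (ea-punchIn t f g)

    statistic-mono : MonotoneWeight W → ∀ {N} →
      Monotonic₂ (Pointwise Fin._≤_) (Pointwise (flip Fin._≤_)) _≤_ (statistic W {N})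
    statistic-mono W-mono f≤f′ g≥g′ = W-mono (ia-mono f≤f′ g≥g′) (ea-antimono f≤f′ g≥g′)

  harris-labellings : ∀ N {F G} → MonotoneWeight F → MonotoneWeight G →
    ∑ᴸ (a H) (b H) N (statistic F) * ∑ᴸ (a H) (b H) N (statistic G)
      ≤ ∑ᴸ (a H) (b H) N (λ _ _ → 1ℚ) * ∑ᴸ (a H) (b H) N (statistic (λ k l → F k l * G k l))
  harris-labellings N {F} {G} F-mono G-mono =
    harris-∑∑ {R = Pointwise Fin._≤_} {S = Pointwise (flip Fin._≤_)} {allFuns (a H) N} {allFuns (b H) N}
      (λ _ → Fin.≤-refl) (λ _ → Fin.≤-refl)
      (harris-allFuns {N} Fin.≤-refl Fin.≤-total (a H))
      (harris-allFuns {N} Fin.≤-refl (flip Fin.≤-total) (b H))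
      (statistic F) (statistic G) (statistic-mono F F-mono) (statistic-mono G G-mono)

-- Harris inequality for a uniformly random permutation

module Permutations (H : BipGraph) where
  open Activity H

  private
    m : ℕ
    m = order H

  ∑π : (ℕ → ℕ → ℚ) → ℚ
  ∑π W = ∑[ π ∈ perms H ] W (ia π) (ea π)

  covπ : (ℕ → ℕ → ℚ) → (ℕ → ℕ → ℚ) → ℚ
  covπ F G = covariance (perms H) (λ π → F (ia π) (ea π)) (λ π → G (ia π) (ea π))

  ∑-perms : ∀ (w : Labelling H → ℚ) → ∑ (perms H) w ≡ ∑ᴵ (a H) (b H) m (λ f g → w (lab f g))
  ∑-perms w = begin
    ∑ (filterᵇ isPerm labellings) w
      ≡⟨ ∑-filter labellings isPerm w ⟩
    ∑[ π ∈ labellings ] (if isPerm π then w π else 0ℚ)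
      ≡⟨ ∑-concatMap (λ f → map (lab f) (allFuns (b H) m)) (allFuns (a H) m) _ ⟩
    ∑[ f ∈ allFuns (a H) m ] ∑ (map (lab f) (allFuns (b H) m)) (λ π → if isPerm π then w π else 0ℚ)
      ≡⟨ ∑-cong (allFuns (a H) m) (λ f → ∑-map (allFuns (b H) m) (lab f) _) ⟩
    ∑ᴵ (a H) (b H) m (λ f g → w (lab f g)) ∎
    where
    open ≡-Reasoning
    labellings : List (Labelling H)
    labellings = concatMap (λ f → map (lab f) (allFuns (b H) m)) (allFuns (a H) m)

  NonNegOnRange : (ℕ → ℕ → ℚ) → Set
  NonNegOnRange W = ∀ {k l} → k ℕ.≤ a H → l ℕ.≤ b H → 0ℚ ≤ W k l

  record BoundedMonotone (W : ℕ → ℕ → ℚ) : Set where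
    field
      monotone : MonotoneWeight W
      nonNeg   : NonNegOnRange W
      bound    : ℚ
      ≤bound   : ∀ {k l} → k ℕ.≤ a H → l ℕ.≤ b H → W k l ≤ bound

  statistic-nonNeg : ∀ {W} → NonNegOnRange W → ∀ {N} (f : LabelsA N) (g : LabelsB N) → 0ℚ ≤ statistic W f g
  statistic-nonNeg 0≤W f g = 0≤W (count≤n (a H) _) (count≤n (b H) _)

  module _ {F G} (F-bm : BoundedMonotone F) (G-bm : BoundedMonotone G) where
    open BoundedMonotone

    private
      FG : ℕ → ℕ → ℚ
      FG k l = F k l * G k l
      s : (ℕ → ℕ → ℚ) → ℚ
      s W = ∑ᴵ (a H) (b H) m (statistic W)
      P K C : ℚ
      P = ∑ᴵ (a H) (b H) m (λ _ _ → 1ℚ)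
      K = bound F-bm * bound G-bm
      C = P * s FG + P * P * K
      0≤FG : NonNegOnRange FG
      0≤FG k≤a l≤b = *-nonNeg (nonNeg F-bm k≤a l≤b) (nonNeg G-bm k≤a l≤b)
      FG≤K : ∀ {k l} → k ℕ.≤ a H → l ℕ.≤ b H → FG k l ≤ K
      FG≤K k≤a l≤b = *-mono-≤ (ℚ.≤-trans (nonNeg F-bm k≤a l≤b) (≤bound F-bm k≤a l≤b)) (nonNeg G-bm k≤a l≤b)
                              (≤bound F-bm k≤a l≤b) (≤bound G-bm k≤a l≤b)
      0≤P : 0ℚ ≤ P
      0≤P = ∑ᴵ-nonNeg {a H} {b H} {m} (λ _ _ → 0≤1)
      0≤sFG : 0ℚ ≤ s FG
      0≤sFG = ∑ᴵ-nonNeg {a H} {b H} {m} (statistic-nonNeg 0≤FG)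
      0≤C : 0ℚ ≤ C
      0≤C = +-nonNeg (*-nonNeg 0≤P 0≤sFG)
                     (*-nonNeg (*-nonNeg 0≤P 0≤P) (ℚ.≤-trans (0≤FG ℕ.z≤n ℕ.z≤n) (FG≤K ℕ.z≤n ℕ.z≤n)))

    harris-approximation : ∀ k → let X = fromℕ (k ℕ.+ m); Nᵐ = X ^ m; Nₘ = fallingFactorial X m in
      Nₘ * Nₘ * (s F * s G) ≤ Nₘ * Nₘ * (P * s FG) + (Nᵐ - Nₘ) * Nᵐ * C
    harris-approximation k =
      subst₂ (λ Nₘ Nᵐ → Nₘ * Nₘ * (s F * s G) ≤ Nₘ * Nₘ * (P * s FG) + (Nᵐ - Nₘ) * Nᵐ * C)
      (∑ᴵ-1 (a H) (b H) N) (∑ᴸ-1 {a H} {b H} {N})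
      (approximate-harris {P} {Nₘ} {Nᵐ} {K} {s F} {s G} {s FG} {S F} {S G} {S FG} {R F} {R G} {R FG}
        0≤P (∑ᴵ-nonNeg {a H} {b H} {N} (λ _ _ → 0≤1)) Nₘ≤Nᵐ 0≤sFG
        (∑ᴵ-nonNeg {a H} {b H} {N} (statistic-nonNeg (nonNeg F-bm)))
        (∑ᴵ-nonNeg {a H} {b H} {N} (statistic-nonNeg (nonNeg G-bm)))
        (∑ᴰ-nonNeg {a H} {b H} {N} (statistic-nonNeg (nonNeg F-bm)))
        (∑ᴰ-nonNeg {a H} {b H} {N} (statistic-nonNeg (nonNeg G-bm)))
        R-FG≤K[Nᵐ-Nₘ] (ratio F) (ratio G) (ratio FG)
        (subst₂ _≤_ (cong₂ _*_ (∑ᴸ-split (statistic F)) (∑ᴸ-split (statistic G)))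
                    (cong (Nᵐ *_) (∑ᴸ-split (statistic FG)))
                    (harris-labellings N (monotone F-bm) (monotone G-bm))))
      where
      N : ℕ
      N = k ℕ.+ m
      S R : (ℕ → ℕ → ℚ) → ℚ
      S W = ∑ᴵ (a H) (b H) N (statistic W)
      R W = ∑ᴰ (a H) (b H) N (statistic W)
      Nₘ Nᵐ : ℚ
      Nₘ = ∑ᴵ (a H) (b H) N (λ _ _ → 1ℚ)
      Nᵐ = ∑ᴸ (a H) (b H) N (λ _ _ → 1ℚ)
      x+y-x≡y : ∀ x y → x + y - x ≡ y
      x+y-x≡y = solve 2 (λ x y → x :+ y :- x := y) refl
      degenerate : ∑ᴰ (a H) (b H) N (λ _ _ → 1ℚ) ≡ Nᵐ - Nₘ
      degenerate = sym (trans (cong (_- Nₘ) (∑ᴸ-split {a H} {b H} {N} (λ _ _ → 1ℚ))) (x+y-x≡y Nₘ _))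
      Nₘ≤Nᵐ : Nₘ ≤ Nᵐ
      Nₘ≤Nᵐ = ℚ.≤-trans (p≤p+q Nₘ (∑ᴰ-nonNeg {a H} {b H} {N} (λ _ _ → 0≤1)))
                        (ℚ.≤-reflexive (sym (∑ᴸ-split {a H} {b H} {N} (λ _ _ → 1ℚ))))
      R-FG≤K[Nᵐ-Nₘ] : R FG ≤ K * (Nᵐ - Nₘ)
      R-FG≤K[Nᵐ-Nₘ] = ℚ.≤-trans
        (∑ᴰ-≤ {a H} {b H} {N} {statistic FG} (λ f g → FG≤K (count≤n (a H) _) (count≤n (b H) _)))
        (ℚ.≤-reflexive (cong (K *_) degenerate))
      ratio : ∀ W → P * S W ≡ Nₘ * s W
      ratio W = ∑ᴵ-ratio {a H} {b H} (statistic W) (statistic-ext W) (statistic-punchIn W) k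

    harris-permutations : ∑π F * ∑π G ≤ card (perms H) * ∑π FG
    harris-permutations = subst₂ _≤_
      (sym (cong₂ _*_ (∑-perms _) (∑-perms _))) (sym (cong₂ _*_ (∑-perms _) (∑-perms _)))
      (fallingFactorial-limit m 0≤C harris-approximation)

    covπ-nonNeg : 0ℚ ≤ covπ F G
    covπ-nonNeg = p≤q⇒0≤q-p harris-permutations

module Weights (H : BipGraph) (x y : ℚ) where
  open Permutations H using (BoundedMonotone; covπ; covπ-nonNeg)

  xᵏ yˡ : ℕ → ℕ → ℚ
  xᵏ k _ = x ^ k
  yˡ _ l = y ^ l

  c-mono : ∀ c {p q} → p ≤ q → c - q ≤ c - p
  c-mono c p≤q = ℚ.+-monoʳ-≤ c (ℚ.neg-antimono-≤ p≤q)

  c-≤ : ∀ c {p} → 0ℚ ≤ p → c - p ≤ c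
  c-≤ c {p} 0≤p = ℚ.≤-trans (c-mono c 0≤p) (ℚ.≤-reflexive (ℚ.+-identityʳ c))

  xᵏ-bm : 1ℚ ≤ x → BoundedMonotone xᵏ
  xᵏ-bm 1≤x = record
    { monotone = λ k≤k′ _ → ^-monoʳ-≤ 1≤x k≤k′
    ; nonNeg   = λ {k} _ _ → ^-nonNeg (ℚ.≤-trans 0≤1 1≤x) k
    ; bound    = x ^ a H
    ; ≤bound   = λ k≤a _ → ^-monoʳ-≤ 1≤x k≤a }

  1-xᵏ-bm : 0ℚ ≤ x → x ≤ 1ℚ → BoundedMonotone (λ k l → 1ℚ - xᵏ k l)
  1-xᵏ-bm 0≤x x≤1 = record
    { monotone = λ k≤k′ _ → c-mono 1ℚ (^-antimonoʳ-≤ 0≤x x≤1 k≤k′)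
    ; nonNeg   = λ {k} _ _ → p≤q⇒0≤q-p (^≤1 0≤x x≤1 k)
    ; bound    = 1ℚ
    ; ≤bound   = λ {k} _ _ → c-≤ 1ℚ (^-nonNeg 0≤x k) }

  yˡ-bm : 0ℚ ≤ y → y ≤ 1ℚ → BoundedMonotone yˡ
  yˡ-bm 0≤y y≤1 = record
    { monotone = λ _ l≥l′ → ^-antimonoʳ-≤ 0≤y y≤1 l≥l′
    ; nonNeg   = λ {_} {l} _ _ → ^-nonNeg 0≤y l
    ; bound    = 1ℚ
    ; ≤bound   = λ {_} {l} _ _ → ^≤1 0≤y y≤1 l }

  yᵇ-yˡ-bm : 1ℚ ≤ y → BoundedMonotone (λ k l → y ^ b H - yˡ k l)
  yᵇ-yˡ-bm 1≤y = record
    { monotone = λ _ l≥l′ → c-mono (y ^ b H) (^-monoʳ-≤ 1≤y l≥l′)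
    ; nonNeg   = λ _ l≤b → p≤q⇒0≤q-p (^-monoʳ-≤ 1≤y l≤b)
    ; bound    = y ^ b H
    ; ≤bound   = λ {_} {l} _ _ → c-≤ (y ^ b H) (^-nonNeg (ℚ.≤-trans 0≤1 1≤y) l) }

  comonotone : ((0ℚ ≤ x × x ≤ 1ℚ) × 1ℚ ≤ y) ⊎ ((0ℚ ≤ y × y ≤ 1ℚ) × 1ℚ ≤ x) → 0ℚ ≤ covπ xᵏ yˡ
  comonotone (inj₁ ((0≤x , x≤1) , 1≤y)) =
    subst (0ℚ ≤_) double-flip (covπ-nonNeg (1-xᵏ-bm 0≤x x≤1) (yᵇ-yˡ-bm 1≤y))
    where
    F G : Labelling H → ℚ
    F π = x ^ ia π
    G π = y ^ ea π
    neg-involutive : ∀ p → - (- p) ≡ p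
    neg-involutive = solve 1 (λ p → :- (:- p) := p) refl
    double-flip : covπ (λ k l → 1ℚ - xᵏ k l) (λ k l → y ^ b H - yˡ k l) ≡ covπ xᵏ yˡ
    double-flip = trans (covariance-flipˡ (perms H) F (λ π → y ^ b H - G π) 1ℚ)
      (trans (cong -_ (covariance-flipʳ (perms H) F G (y ^ b H))) (neg-involutive (covπ xᵏ yˡ)))
  comonotone (inj₂ ((0≤y , y≤1) , 1≤x)) = covπ-nonNeg (xᵏ-bm 1≤x) (yˡ-bm 0≤y y≤1)

  antimonotone : (1ℚ ≤ x × 1ℚ ≤ y) ⊎ ((0ℚ ≤ x × x ≤ 1ℚ) × (0ℚ ≤ y × y ≤ 1ℚ)) → covπ xᵏ yˡ ≤ 0ℚ
  antimonotone (inj₁ (1≤x , 1≤y)) = 0≤-p⇒p≤0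
    (subst (0ℚ ≤_) (covariance-flipʳ (perms H) (λ π → x ^ ia π) (λ π → y ^ ea π) (y ^ b H))
      (covπ-nonNeg (xᵏ-bm 1≤x) (yᵇ-yˡ-bm 1≤y)))
  antimonotone (inj₂ ((0≤x , x≤1) , (0≤y , y≤1))) = 0≤-p⇒p≤0
    (subst (0ℚ ≤_) (covariance-flipˡ (perms H) (λ π → x ^ ia π) (λ π → y ^ ea π) 1ℚ)
      (covπ-nonNeg (1-xᵏ-bm 0≤x x≤1) (yˡ-bm 0≤y y≤1)))

  normalisation : ℚ
  normalisation = ((ℤ.+ 1) ℚ./ (order H !)) {{order H !≢0}}

  Ttilde-covariance : Ttilde H x y * Ttilde H 1ℚ 1ℚ - Ttilde H x 1ℚ * Ttilde H 1ℚ y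
                    ≡ normalisation * normalisation * covπ xᵏ yˡ
  Ttilde-covariance = trans
    (cong₂ (λ p q → c * ∑ (perms H) FG * p - q) Ttilde-1-1 (cong₂ _*_ Ttilde-x-1 Ttilde-1-y))
    (identity c (card (perms H)) (∑ (perms H) FG) (∑ (perms H) F) (∑ (perms H) G))
    where
    c : ℚ
    c = normalisation
    F G FG : Labelling H → ℚ
    F π = x ^ ia π
    G π = y ^ ea π
    FG π = F π * G π
    Ttilde-1-1 : Ttilde H 1ℚ 1ℚ ≡ c * card (perms H)
    Ttilde-1-1 = cong (c *_) (∑-cong (perms H) (λ π → trans (cong₂ _*_ (1^ (ia π)) (1^ (ea π))) (ℚ.*-identityˡ 1ℚ)))
    Ttilde-x-1 : Ttilde H x 1ℚ ≡ c * ∑ (perms H) F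
    Ttilde-x-1 = cong (c *_) (∑-cong (perms H) (λ π → trans (cong (F π *_) (1^ (ea π))) (ℚ.*-identityʳ (F π))))
    Ttilde-1-y : Ttilde H 1ℚ y ≡ c * ∑ (perms H) G
    Ttilde-1-y = cong (c *_) (∑-cong (perms H) (λ π → trans (cong (_* G π) (1^ (ia π))) (ℚ.*-identityˡ (G π))))
    identity : ∀ c n sFG sF sG → c * sFG * (c * n) - c * sF * (c * sG) ≡ c * c * (n * sFG - sF * sG)
    identity = solve 5 (λ c n sFG sF sG →
      c :* sFG :* (c :* n) :- c :* sF :* (c :* sG) := c :* c :* (n :* sFG :- sF :* sG)) refl

mainTheorem10 : (H : BipGraph) → (x y : ℚ) →
    ((((0ℚ ≤ x × x ≤ 1ℚ) × 1ℚ ≤ y) ⊎ ((0ℚ ≤ y × y ≤ 1ℚ) × 1ℚ ≤ x)) →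
      Ttilde H x 1ℚ * Ttilde H 1ℚ y ≤ Ttilde H x y * Ttilde H 1ℚ 1ℚ)
    × (((1ℚ ≤ x × 1ℚ ≤ y) ⊎ ((0ℚ ≤ x × x ≤ 1ℚ) × (0ℚ ≤ y × y ≤ 1ℚ))) →
      Ttilde H x y * Ttilde H 1ℚ 1ℚ ≤ Ttilde H x 1ℚ * Ttilde H 1ℚ y)
mainTheorem10 H x y =
  (λ cases → 0≤q-p⇒p≤q (subst (0ℚ ≤_) (sym Ttilde-covariance) (*-nonNeg 0≤c² (comonotone cases)))) ,
  (λ cases → p-q≤0⇒p≤q (subst (_≤ 0ℚ) (sym Ttilde-covariance)
    (ℚ.≤-trans (*-monoˡ-≤ 0≤c² (antimonotone cases)) (ℚ.≤-reflexive (ℚ.*-zeroʳ (normalisation * normalisation))))))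
  where
  open Weights H x y
  0≤c² : 0ℚ ≤ normalisation * normalisation
  0≤c² = square-nonNeg normalisation
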